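{- Let $k\ge1$, $c\ge1$, $m,\ell\ge1$, and let $(h_1,h_2)$ be chosen uniformly at random from $\mathcal{Z}^{2k,c}_{\ell,m}$. For every $T\subseteq U$: (a) $\Pr(\mathrm{bad}_T\cup\mathrm{crit}_T)\le\bigl(|T|^{2k}/\ell^k\bigr)^c$; (b) conditioned on $\mathrm{good}_T$ (or on $\mathrm{crit}_T$), the pairs $(h_1(x),h_2(x))$, $x\in T$, are distributed uniformly and independently in $[m]^2$.
   Context: $U$ is a finite set. $\mathcal{H}^\kappa_r$ denotes an arbitrary $\kappa$-wise independent family of functions $U\to[r]=\{0,\dots,r-1\}$ (for distinct $x_1,\dots,x_\kappa$ and any targets $j_1,\dots,j_\kappa$, $\Pr(h(x_i)=j_i\ \forall i)=r^{ -\kappa}$). $\mathcal{Z}^{2k,c}_{\ell,m}$ is the family of pairs $(h_1,h_2)$ given by $f_1,f_2\in\mathcal{H}^{2k}_m$, $g_1,\dots,g_c\in\mathcal{H}^{2k}_\ell$, $z^{(i)}_j\in[m]^\ell$ ($1\le j\le c$, $i\in\{1,2\}$), with $h_i(x)=(f_i(x)+\sum_{j=1}^c z^{(i)}_j[g_j(x)])\bmod m$; uniform choice means all components are chosen independently and uniformly. For $T\subseteq U$ the deficiency is $d_T=|T|-\max\{k,|g_1(T)|,\dots,|g_c(T)|\}$; $\mathrm{bad}_T$ is the event $d_T>k$, $\mathrm{good}_T$ the event $d_T\le k$, and $\mathrm{crit}_T$ the event $d_T=k$. -}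

module Defs where

open import Data.Bool using (Bool; true; false; _∧_; _∨_; not; if_then_else_)
open import Data.Nat using (ℕ; zero; suc; _+_; _*_; _^_; _≤_; _⊔_; NonZero)
open import Data.Nat.DivMod using (_mod_)
open import Data.Bool.ListAction using (all; any)
open import Data.Fin using (Fin; toℕ; _≟_)
open import Data.Fin.Subset using (Subset; ∣_∣)
open import Data.Integer as ℤ using (ℤ; +_)
open import Data.List as List using (List; []; _∷_; [_]; length; concatMap; allFin)
open import Data.Vec as Vec using (Vec; lookup; tabulate; toList)
open import Data.Product using (_×_; _,_; proj₁; proj₂)
open import Function.Definitions using (Injective)
open import Relation.Binary.PropositionalEquality using (_≡_; _≢_)
open import Relation.Nullary.Decidable using (⌊_⌋)

-- The universe U is Fin n.

count : {A : Set} → (A → Bool) → List A → ℕ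
count p []       = 0
count p (x ∷ xs) = (if p x then 1 else 0) + count p xs

vecsOver : {A : Set} → List A → (c : ℕ) → List (Vec A c)
vecsOver xs zero    = [ Vec.[] ]
vecsOver xs (suc c) = concatMap (λ x → List.map (x Vec.∷_) (vecsOver xs c)) xs

-- A family of functions U → [r] is a (nonempty) list, sampled uniformly
-- (with multiplicity).  κ-wise independence: for any j ≤ κ distinct points
-- xs and targets js, Pr(h(xs i) = js i ∀ i) = r^(-j), stated by counting.
hits : {n r j : ℕ} → (Fin j → Fin n) → (Fin j → Fin r) → (Fin n → Fin r) → Bool
hits {j = j} xs js h = all (λ i → ⌊ h (xs i) ≟ js i ⌋) (allFin j)

IsIndependent : (n κ r : ℕ) → List (Fin n → Fin r) → Set
IsIndependent n κ r F =
  (F ≢ []) ×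
  (∀ (j : ℕ) → j ≤ κ → (xs : Fin j → Fin n) → Injective _≡_ _≡_ xs →
     (js : Fin j → Fin r) → count (hits xs js) F * r ^ j ≡ length F)

-- An element of the family Z^{2k,c}_{ℓ,m}: (f₁, f₂, g₁..g_c, z^{(1)}, z^{(2)})
record Sample (n ℓ m c : ℕ) : Set where
  constructor sample
  field
    f₁ f₂ : Fin n → Fin m
    gs    : Vec (Fin n → Fin ℓ) c
    z₁ z₂ : Vec (Vec (Fin m) ℓ) c
open Sample public

space : {n ℓ m : ℕ} (c : ℕ) → List (Fin n → Fin m) → List (Fin n → Fin ℓ) →
        List (Sample n ℓ m c)
space {n} {ℓ} {m} c F G =
  concatMap (λ f1 →
  concatMap (λ f2 →
  concatMap (λ gs →
  concatMap (λ z1 →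
  List.map (λ z2 → sample f1 f2 gs z1 z2) Zs) Zs) (vecsOver G c)) F) F
  where
  Zs : List (Vec (Vec (Fin m) ℓ) c)
  Zs = vecsOver (vecsOver (allFin m) ℓ) c

hashWith : {n ℓ m c : ℕ} .{{_ : NonZero m}} →
           (Fin n → Fin m) → Vec (Vec (Fin m) ℓ) c → Vec (Fin n → Fin ℓ) c →
           Fin n → Fin m
hashWith {m = m} f z gs x =
  (toℕ (f x) + Vec.sum (Vec.zipWith (λ zj gj → toℕ (lookup zj (gj x))) z gs)) mod m

h₁ h₂ : {n ℓ m c : ℕ} .{{_ : NonZero m}} → Sample n ℓ m c → Fin n → Fin m
h₁ s = hashWith (f₁ s) (z₁ s) (gs s)
h₂ s = hashWith (f₂ s) (z₂ s) (gs s)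

image : {n ℓ : ℕ} → (Fin n → Fin ℓ) → Subset n → Subset ℓ
image {n} g T = tabulate (λ y → any (λ x → lookup T x ∧ ⌊ g x ≟ y ⌋) (allFin n))

deficiency : {n ℓ m c : ℕ} → (k : ℕ) → Subset n → Sample n ℓ m c → ℤ
deficiency k T s =
  + ∣ T ∣ ℤ.- + (List.foldr _⊔_ k (List.map (λ g → ∣ image g T ∣) (toList (gs s))))

bad good crit : {n ℓ m c : ℕ} → (k : ℕ) → Subset n → Sample n ℓ m c → Bool
bad  k T s = ⌊ + k ℤ.<? deficiency k T s ⌋
good k T s = ⌊ deficiency k T s ℤ.≤? + k ⌋
crit k T s = ⌊ deficiency k T s ℤ.≟ + k ⌋

matches : {n ℓ m c : ℕ} .{{_ : NonZero m}} → Subset n → (Fin n → Fin m × Fin m) →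
          Sample n ℓ m c → Bool
matches {n} T a s =
  all (λ x → not (lookup T x) ∨
                  (⌊ h₁ s x ≟ proj₁ (a x) ⌋ ∧ ⌊ h₂ s x ≟ proj₂ (a x) ⌋)) (allFin n)

-- Fix g₁ … g_c and write h = f + Σⱼ z⁽ʲ⁾[gⱼ]. If some round j has |T| ≤ k + |gⱼ(T)|, the rounds
-- before it are absorbed into f, which stays 2k-wise independent, and the rounds after it into
-- the offset. In round j pick a representative in each class of gⱼ on T: the representatives
-- read distinct coordinates of the uniform vector z⁽ʲ⁾, and every other point of T is linked to
-- its representative. The offset is uniform on T as soon as f respects the at most k links, and
-- each link involves at most two new points, so 2k-wise independence of f suffices. This gives
-- (b); the case |T| ≤ 2k is independence itself. For (a), d_T ≥ k forces every gⱼ to have k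
-- links among the |T|² pairs of points of T, and a fixed sequence of k fresh links is respected
-- with probability ℓ^−k; the gⱼ are independent, whence the c-th power.

module Submission where

open import Defs
open import Data.Bool using (Bool; true; false; _∧_; _∨_; not; if_then_else_)
open import Data.Bool.ListAction using (all; any)
open import Data.Bool.Properties using (∧-zeroʳ; ∧-identityʳ; ∧-assoc; ∧-comm; ∨-zeroʳ)
open import Data.Empty using (⊥-elim)
open import Data.Fin using (Fin; toℕ; _≟_) renaming (zero to fz; suc to fs)
open import Data.Fin.Properties using (toℕ-injective; toℕ<n; toℕ-fromℕ<) renaming (suc-injective to fs-injective)
open import Data.Fin.Subset using (Subset; ∣_∣)
open import Data.Integer as ℤ using (ℤ)
import Data.Integer.Properties as ℤP
open import Data.Integer.Tactic.RingSolver using () renaming (solve-∀ to ℤsolve-∀)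
open import Data.List as List using (List; []; _∷_; length; concatMap; allFin; _++_)
open import Data.List.Membership.Propositional using (_∈_; _∉_)
import Data.List.Membership.DecPropositional as DecMembership
open import Data.List.Membership.Propositional.Properties
  using (∈-map⁺; ∈-map⁻; ∈-lookup; ∈-∃++; ∈-++⁻; ∈-++⁺ˡ; ∈-++⁺ʳ; ∈-allFin; ∈-concatMap⁺)
import Data.List.Properties as LP
open import Data.List.Relation.Unary.All as All using (All; []; _∷_)
open import Data.List.Relation.Unary.All.Properties using (¬Any⇒All¬; All¬⇒¬Any)
open import Data.List.Relation.Unary.AllPairs using ([]; _∷_)
open import Data.List.Relation.Unary.Any as LAny using (here; there)
open import Data.List.Relation.Unary.Unique.Propositional using (Unique)
import Data.List.Relation.Unary.Unique.Propositional.Properties as Unique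
open import Data.Maybe using (Maybe; just; nothing)
open import Data.Nat using (ℕ; zero; suc; _+_; _*_; _^_; _≤_; _<_; _∸_; _⊔_; NonZero; s≤s; z≤n; _≤?_; >-nonZero)
open import Data.Nat.DivMod using (_mod_; _%_; %-distribˡ-+; m%n%n≡m%n; m<n⇒m%n≡m; [m+n]%n≡m%n; m%n<n)
open import Data.Nat.Properties hiding (_≟_)
open import Algebra.Properties.CommutativeSemigroup +-commutativeSemigroup using () renaming (interchange to +-interchange)
open import Data.Nat.Tactic.RingSolver using (solve-∀)
open import Data.Product using (_×_; _,_; proj₁; proj₂; ∃)
open import Data.Sum using (_⊎_; inj₁; inj₂)
open import Data.Unit using (⊤; tt)
open import Data.Vec as Vec using (Vec) renaming ([] to []ᵥ; _∷_ to _∷ᵥ_)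
import Data.Vec.Properties as VP
open import Data.Vec.Relation.Unary.Any as VAny using () renaming (here to hereᵥ; there to thereᵥ)
open import Function using (_∘_)
open import Function.Definitions using (Injective)
open import Relation.Binary.PropositionalEquality
open import Relation.Nullary using (Dec; yes; no)
open import Relation.Nullary.Decidable using (⌊_⌋; does; dec-true; ¬?; _×-dec_)

ind : Bool → ℕ
ind b = if b then 1 else 0

∑ : {A : Set} → List A → (A → ℕ) → ℕ
∑ []       w = 0
∑ (x ∷ xs) w = w x + ∑ xs w

module _ {A : Set} where

  count≡sum : (p : A → Bool) (xs : List A) → count p xs ≡ ∑ xs (ind ∘ p)
  count≡sum p []       = refl
  count≡sum p (x ∷ xs) = cong (ind (p x) +_) (count≡sum p xs)

  length≡sum : (xs : List A) → length xs ≡ ∑ xs (λ _ → 1)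
  length≡sum []       = refl
  length≡sum (x ∷ xs) = cong suc (length≡sum xs)

  sum-cong : (xs : List A) {w w′ : A → ℕ} → (∀ x → w x ≡ w′ x) → ∑ xs w ≡ ∑ xs w′
  sum-cong []       e = refl
  sum-cong (x ∷ xs) e = cong₂ _+_ (e x) (sum-cong xs e)

  sum-++ : (xs ys : List A) (w : A → ℕ) → ∑ (xs ++ ys) w ≡ ∑ xs w + ∑ ys w
  sum-++ []       ys w = refl
  sum-++ (x ∷ xs) ys w = trans (cong (w x +_) (sum-++ xs ys w)) (sym (+-assoc (w x) _ _))

  sum-+ : (xs : List A) (w w′ : A → ℕ) → ∑ xs (λ x → w x + w′ x) ≡ ∑ xs w + ∑ xs w′
  sum-+ []       w w′ = refl
  sum-+ (x ∷ xs) w w′ = trans (cong (w x + w′ x +_) (sum-+ xs w w′)) (+-interchange (w x) (w′ x) _ _)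

  sum-*ˡ : (c : ℕ) (xs : List A) (w : A → ℕ) → ∑ xs (λ x → c * w x) ≡ c * ∑ xs w
  sum-*ˡ c []       w = sym (*-zeroʳ c)
  sum-*ˡ c (x ∷ xs) w = trans (cong (c * w x +_) (sum-*ˡ c xs w)) (sym (*-distribˡ-+ c (w x) _))

  sum-*ʳ : (c : ℕ) (xs : List A) (w : A → ℕ) → ∑ xs (λ x → w x * c) ≡ ∑ xs w * c
  sum-*ʳ c xs w = trans (sum-cong xs (λ x → *-comm (w x) c)) (trans (sum-*ˡ c xs w) (*-comm c _))

  sum-const : (xs : List A) (c : ℕ) → ∑ xs (λ _ → c) ≡ length xs * c
  sum-const []       c = refl
  sum-const (x ∷ xs) c = cong (c +_) (sum-const xs c)

  sum-zero : (xs : List A) → ∑ xs (λ _ → 0) ≡ 0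
  sum-zero xs = trans (sum-const xs 0) (*-zeroʳ (length xs))

  sum-mono : (xs : List A) {w w′ : A → ℕ} → (∀ x → w x ≤ w′ x) → ∑ xs w ≤ ∑ xs w′
  sum-mono []       e = ≤-refl
  sum-mono (x ∷ xs) e = +-mono-≤ (e x) (sum-mono xs e)

  ∈⇒≤-sum : (xs : List A) (w : A → ℕ) {x : A} → x ∈ xs → w x ≤ ∑ xs w
  ∈⇒≤-sum (y ∷ ys) w (here refl) = m≤m+n (w y) _
  ∈⇒≤-sum (y ∷ ys) w (there p)   = ≤-trans (∈⇒≤-sum ys w p) (m≤n+m _ (w y))

module _ {A B : Set} where

  sum-map : (f : A → B) (xs : List A) (w : B → ℕ) → ∑ (List.map f xs) w ≡ ∑ xs (w ∘ f)
  sum-map f []       w = refl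
  sum-map f (x ∷ xs) w = cong (w (f x) +_) (sum-map f xs w)

  sum-concatMap : (f : A → List B) (xs : List A) (w : B → ℕ) →
                  ∑ (concatMap f xs) w ≡ ∑ xs (λ x → ∑ (f x) w)
  sum-concatMap f []       w = refl
  sum-concatMap f (x ∷ xs) w =
    trans (sum-++ (f x) (concatMap f xs) w) (cong (∑ (f x) w +_) (sum-concatMap f xs w))

  sum-swap : (xs : List A) (ys : List B) (w : A → B → ℕ) →
             ∑ xs (λ x → ∑ ys (λ y → w x y)) ≡ ∑ ys (λ y → ∑ xs (λ x → w x y))
  sum-swap []       ys w = sym (sum-zero ys)
  sum-swap (x ∷ xs) ys w = trans (cong (∑ ys (w x) +_) (sum-swap xs ys w))
                                 (sym (sum-+ ys (w x) (λ y → ∑ xs (λ x′ → w x′ y))))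

  sum-product : (xs : List A) (ys : List B) (u : A → ℕ) (v : B → ℕ) →
                ∑ xs (λ x → ∑ ys (λ y → u x * v y)) ≡ ∑ xs u * ∑ ys v
  sum-product xs ys u v =
    trans (sum-cong xs (λ x → sum-*ˡ (u x) ys v)) (sum-*ʳ (∑ ys v) xs u)

  length-concatMap : (f : A → List B) (xs : List A) → length (concatMap f xs) ≡ ∑ xs (length ∘ f)
  length-concatMap f xs = trans (length≡sum (concatMap f xs))
    (trans (sum-concatMap f xs (λ _ → 1)) (sum-cong xs (λ x → sym (length≡sum (f x)))))

sum-separate : {A B C D : Set} (as : List A) (bs : List B) (cs : List C) (ds : List D)
               (u : A → C → ℕ) (v : B → D → ℕ) →
               ∑ as (λ a → ∑ bs (λ b → ∑ cs (λ c → ∑ ds (λ d → u a c * v b d))))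
                 ≡ ∑ as (λ a → ∑ cs (u a)) * ∑ bs (λ b → ∑ ds (v b))
sum-separate as bs cs ds u v =
  trans (sum-cong as (λ a → sum-cong bs (λ b → sum-product cs ds (u a) (v b))))
        (sum-product as bs (λ a → ∑ cs (u a)) (λ b → ∑ ds (v b)))

ind-∧ : (a b : Bool) → ind (a ∧ b) ≡ ind a * ind b
ind-∧ false b = refl
ind-∧ true  b = sym (+-identityʳ (ind b))

module _ {A : Set} where

  count-cong : (xs : List A) {p q : A → Bool} → (∀ x → p x ≡ q x) → count p xs ≡ count q xs
  count-cong xs {p} {q} e =
    trans (count≡sum p xs) (trans (sum-cong xs (λ x → cong ind (e x))) (sym (count≡sum q xs)))

  count-const∧ : (b : Bool) (p : A → Bool) (xs : List A) → count (λ x → b ∧ p x) xs ≡ ind b * count p xs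
  count-const∧ b p xs = trans (count≡sum _ xs) (trans (sum-cong xs (λ x → ind-∧ b (p x)))
                          (trans (sum-*ˡ (ind b) xs _) (cong (ind b *_) (sym (count≡sum p xs)))))

  count-true : (xs : List A) → count (λ _ → true) xs ≡ length xs
  count-true []       = refl
  count-true (x ∷ xs) = cong suc (count-true xs)

  count-mono : (p q : A → Bool) (xs : List A) → (∀ x → p x ≡ true → q x ≡ true) → count p xs ≤ count q xs
  count-mono p q xs p⇒q = begin
      count p xs      ≡⟨ count≡sum p xs ⟩
      ∑ xs (ind ∘ p)  ≤⟨ sum-mono xs ind-mono ⟩
      ∑ xs (ind ∘ q)  ≡⟨ count≡sum q xs ⟨
      count q xs      ∎
    where
    open ≤-Reasoning
    ind-mono : ∀ x → ind (p x) ≤ ind (q x)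
    ind-mono x with p x in px
    ... | false = z≤n
    ... | true rewrite p⇒q x px = ≤-refl

  union-bound : {S : Set} (p : A → Bool) (E : S → A → Bool) (ss : List S) (xs : List A) →
    (∀ x → p x ≡ true → ∃ λ s → s ∈ ss × E s x ≡ true) → count p xs ≤ ∑ ss (λ s → count (E s) xs)
  union-bound p E ss xs covered = begin
      count p xs                                ≡⟨ count≡sum p xs ⟩
      ∑ xs (ind ∘ p)                            ≤⟨ sum-mono xs ind-covered ⟩
      ∑ xs (λ x → ∑ ss (λ s → ind (E s x)))     ≡⟨ sum-swap xs ss _ ⟩
      ∑ ss (λ s → ∑ xs (λ x → ind (E s x)))     ≡⟨ sum-cong ss (λ s → count≡sum (E s) xs) ⟨
      ∑ ss (λ s → count (E s) xs)               ∎
    where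
    open ≤-Reasoning
    ind-covered : ∀ x → ind (p x) ≤ ∑ ss (λ s → ind (E s x))
    ind-covered x with p x in px
    ... | false = z≤n
    ... | true with covered x px
    ...   | s , s∈ss , Esx =
      subst (λ b → ind b ≤ ∑ ss (λ s → ind (E s x))) Esx (∈⇒≤-sum ss (λ s → ind (E s x)) s∈ss)

sum-tabulate : {A : Set} (n : ℕ) (h : Fin n → A) (w : A → ℕ) → ∑ (List.tabulate h) w ≡ ∑ (allFin n) (w ∘ h)
sum-tabulate zero    h w = refl
sum-tabulate (suc n) h w =
  cong (w (h fz) +_) (trans (sum-tabulate n (h ∘ fs) w) (sym (sum-tabulate n fs (w ∘ h))))

length-allFin : (n : ℕ) → length (allFin n) ≡ n
length-allFin n = LP.length-tabulate {n = n} (λ i → i)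

eqb : {n : ℕ} → Fin n → Fin n → Bool
eqb a b = ⌊ a ≟ b ⌋

eqb-refl : {n : ℕ} (a : Fin n) → eqb a a ≡ true
eqb-refl a with a ≟ a
... | yes _  = refl
... | no a≢a = ⊥-elim (a≢a refl)

eqb-sound : {n : ℕ} (a b : Fin n) → eqb a b ≡ true → a ≡ b
eqb-sound a b e with a ≟ b
eqb-sound a b e  | yes a≡b = a≡b
eqb-sound a b () | no _

eqb-sym : {n : ℕ} (a b : Fin n) → eqb a b ≡ eqb b a
eqb-sym a b with a ≟ b | b ≟ a
... | yes _   | yes _   = refl
... | no _    | no _    = refl
... | yes a≡b | no b≢a  = ⊥-elim (b≢a (sym a≡b))
... | no a≢b  | yes b≡a = ⊥-elim (a≢b (sym b≡a))

eqb-suc : {n : ℕ} (a b : Fin n) → eqb (fs a) (fs b) ≡ eqb a b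
eqb-suc a b with a ≟ b
... | yes _ = refl
... | no _  = refl

ExactlyOne : {r : ℕ} → (Fin r → Bool) → Set
ExactlyOne {r} E = ∑ (allFin r) (ind ∘ E) ≡ 1

exactlyOne-eqb : {r : ℕ} (u : Fin r) → ExactlyOne (eqb u)
exactlyOne-eqb {suc r} fz = cong (1 +_) (begin
    ∑ (List.tabulate {n = r} fs) (ind ∘ eqb fz)  ≡⟨ sum-tabulate r fs (ind ∘ eqb fz) ⟩
    ∑ (allFin r) (λ _ → 0)                      ≡⟨ sum-zero (allFin r) ⟩
    0                                           ∎)
  where open ≡-Reasoning
exactlyOne-eqb {suc r} (fs u) = begin
    ∑ (List.tabulate {n = r} fs) (ind ∘ eqb (fs u))  ≡⟨ sum-tabulate r fs (ind ∘ eqb (fs u)) ⟩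
    ∑ (allFin r) (λ v → ind (eqb (fs u) (fs v)))    ≡⟨ sum-cong (allFin r) (λ v → cong ind (eqb-suc u v)) ⟩
    ∑ (allFin r) (ind ∘ eqb u)                      ≡⟨ exactlyOne-eqb u ⟩
    1                                               ∎
  where open ≡-Reasoning

exactlyOne-eqbʳ : {r : ℕ} (u : Fin r) → ExactlyOne (λ v → eqb v u)
exactlyOne-eqbʳ {r} u = trans (sum-cong (allFin r) (λ v → cong ind (eqb-sym v u))) (exactlyOne-eqb u)

∧≡true : (a b : Bool) → a ∧ b ≡ true → (a ≡ true) × (b ≡ true)
∧≡true true true e = refl , refl

true≢false : {b : Bool} → b ≡ true → b ≢ false
true≢false refl ()

module ModularArithmetic (m : ℕ) .{{_ : NonZero m}} where

  addMod : Fin m → Fin m → Fin m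
  addMod u w = (toℕ u + toℕ w) mod m

  -- m ∸ toℕ w is the representative of −w; truncated subtraction never bites since toℕ w < m.
  subMod : Fin m → Fin m → Fin m
  subMod t w = (toℕ t + (m ∸ toℕ w)) mod m

  toℕ-mod : (a : ℕ) → toℕ (a mod m) ≡ a % m
  toℕ-mod a = toℕ-fromℕ< (m%n<n a m)

  toℕ%m : (u : Fin m) → toℕ u % m ≡ toℕ u
  toℕ%m u = m<n⇒m%n≡m (toℕ<n u)

  [a%m+b]%m≡[a+b]%m : (a b : ℕ) → (a % m + b) % m ≡ (a + b) % m
  [a%m+b]%m≡[a+b]%m a b = trans (%-distribˡ-+ (a % m) b m)
    (trans (cong (λ x → (x + b % m) % m) (m%n%n≡m%n a m)) (sym (%-distribˡ-+ a b m)))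

  [a+b%m]%m≡[a+b]%m : (a b : ℕ) → (a + b % m) % m ≡ (a + b) % m
  [a+b%m]%m≡[a+b]%m a b = trans (cong (_% m) (+-comm a (b % m)))
    (trans ([a%m+b]%m≡[a+b]%m b a) (cong (_% m) (+-comm b a)))

  addMod-subMod : (u w : Fin m) → subMod (addMod u w) w ≡ u
  addMod-subMod u w = toℕ-injective (begin
      toℕ (subMod (addMod u w) w)                    ≡⟨ toℕ-mod _ ⟩
      (toℕ (addMod u w) + (m ∸ toℕ w)) % m           ≡⟨ cong (λ x → (x + (m ∸ toℕ w)) % m) (toℕ-mod _) ⟩
      ((toℕ u + toℕ w) % m + (m ∸ toℕ w)) % m        ≡⟨ [a%m+b]%m≡[a+b]%m _ _ ⟩
      (toℕ u + toℕ w + (m ∸ toℕ w)) % m              ≡⟨ cong (_% m) (+-assoc (toℕ u) _ _) ⟩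
      (toℕ u + (toℕ w + (m ∸ toℕ w))) % m            ≡⟨ cong (λ x → (toℕ u + x) % m) (m+[n∸m]≡n (<⇒≤ (toℕ<n w))) ⟩
      (toℕ u + m) % m                                ≡⟨ [m+n]%n≡m%n (toℕ u) m ⟩
      toℕ u % m                                      ≡⟨ toℕ%m u ⟩
      toℕ u                                          ∎)
    where open ≡-Reasoning

  subMod-addMod : (t w : Fin m) → addMod (subMod t w) w ≡ t
  subMod-addMod t w = toℕ-injective (begin
      toℕ (addMod (subMod t w) w)                    ≡⟨ toℕ-mod _ ⟩
      (toℕ (subMod t w) + toℕ w) % m                 ≡⟨ cong (λ x → (x + toℕ w) % m) (toℕ-mod _) ⟩
      ((toℕ t + (m ∸ toℕ w)) % m + toℕ w) % m        ≡⟨ [a%m+b]%m≡[a+b]%m _ _ ⟩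
      (toℕ t + (m ∸ toℕ w) + toℕ w) % m              ≡⟨ cong (_% m) (+-assoc (toℕ t) _ _) ⟩
      (toℕ t + ((m ∸ toℕ w) + toℕ w)) % m            ≡⟨ cong (λ x → (toℕ t + x) % m) (m∸n+n≡m (<⇒≤ (toℕ<n w))) ⟩
      (toℕ t + m) % m                                ≡⟨ [m+n]%n≡m%n (toℕ t) m ⟩
      toℕ t % m                                      ≡⟨ toℕ%m t ⟩
      toℕ t                                          ∎)
    where open ≡-Reasoning

  addMod-comm : (u w : Fin m) → addMod u w ≡ addMod w u
  addMod-comm u w = cong (_mod m) (+-comm (toℕ u) (toℕ w))

  eqb-addMod : (u w t : Fin m) → eqb (addMod u w) t ≡ eqb u (subMod t w)
  eqb-addMod u w t with addMod u w ≟ t | u ≟ subMod t w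
  ... | yes _ | yes _ = refl
  ... | no _  | no _  = refl
  ... | yes u+w≡t | no u≢t-w = ⊥-elim (u≢t-w (trans (sym (addMod-subMod u w)) (cong (λ x → subMod x w) u+w≡t)))
  ... | no u+w≢t  | yes u≡t-w = ⊥-elim (u+w≢t (trans (cong (λ x → addMod x w) u≡t-w) (subMod-addMod t w)))

  eqb-subMod : (s v t : Fin m) → eqb (subMod s v) t ≡ eqb v (subMod s t)
  eqb-subMod s v t = begin
    eqb (subMod s v) t  ≡⟨ eqb-sym (subMod s v) t ⟩
    eqb t (subMod s v)  ≡⟨ eqb-addMod t v s ⟨
    eqb (addMod t v) s  ≡⟨ cong (λ w → eqb w s) (addMod-comm t v) ⟩
    eqb (addMod v t) s  ≡⟨ eqb-addMod v t s ⟩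
    eqb v (subMod s t)  ∎
    where open ≡-Reasoning

-- Independence, stated for explicit point-value assignments

Assignment : ℕ → ℕ → Set
Assignment n r = List (Fin n × Fin r)

fits : {n r : ℕ} → Assignment n r → (Fin n → Fin r) → Bool
fits []             f = true
fits ((p , v) ∷ ps) f = eqb (f p) v ∧ fits ps f

points : {n r : ℕ} → Assignment n r → List (Fin n)
points = List.map proj₁

Independent : (n κ r : ℕ) → List (Fin n → Fin r) → Set
Independent n κ r F = ∀ (ps : Assignment n r) → Unique (points ps) → length ps ≤ κ →
                      count (fits ps) F * r ^ length ps ≡ length F

all-tabulate : {A : Set} (n : ℕ) (h : Fin n → A) (P : A → Bool) →
               all P (List.tabulate h) ≡ all (P ∘ h) (allFin n)
all-tabulate zero    h P = refl
all-tabulate (suc n) h P =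
  cong (P (h fz) ∧_) (trans (all-tabulate n (h ∘ fs) P) (sym (all-tabulate n fs (P ∘ h))))

hits≡fits : {n r : ℕ} (ps : Assignment n r) (f : Fin n → Fin r) →
            hits (λ i → proj₁ (List.lookup ps i)) (λ i → proj₂ (List.lookup ps i)) f ≡ fits ps f
hits≡fits []             f = refl
hits≡fits ((p , v) ∷ ps) f = cong (eqb (f p) v ∧_) (trans (all-tabulate (length ps) fs _) (hits≡fits ps f))

lookup-points-injective : {n r : ℕ} (ps : Assignment n r) → Unique (points ps) →
                          Injective _≡_ _≡_ (λ i → proj₁ (List.lookup ps i))
lookup-points-injective (q ∷ ps) u             {fz}   {fz}   e = refl
lookup-points-injective (q ∷ ps) (q∉ps ∷ u)    {fz}   {fs j} e =
  ⊥-elim (All.lookup q∉ps (∈-map⁺ proj₁ (∈-lookup j)) e)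
lookup-points-injective (q ∷ ps) (q∉ps ∷ u)    {fs i} {fz}   e =
  ⊥-elim (All.lookup q∉ps (∈-map⁺ proj₁ (∈-lookup i)) (sym e))
lookup-points-injective (q ∷ ps) (_ ∷ u)       {fs i} {fs j} e = cong fs (lookup-points-injective ps u e)

IsIndependent⇒Independent : {n κ r : ℕ} (F : List (Fin n → Fin r)) →
                            IsIndependent n κ r F → Independent n κ r F
IsIndependent⇒Independent F (_ , independent) ps unique ps≤κ =
  trans (cong (_* _) (count-cong F (λ f → sym (hits≡fits ps f))))
        (independent (length ps) ps≤κ _ (lookup-points-injective ps unique) _)

count-by-value : {n r : ℕ} (y : Fin n) (p : (Fin n → Fin r) → Bool) (F : List (Fin n → Fin r)) →
                 count p F ≡ ∑ (allFin r) (λ v → count (λ f → eqb (f y) v ∧ p f) F)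
count-by-value {r = r} y p F = sym (begin
    ∑ (allFin r) (λ v → count (λ f → eqb (f y) v ∧ p f) F)
      ≡⟨ sum-cong (allFin r) (λ v → count≡sum _ F) ⟩
    ∑ (allFin r) (λ v → ∑ F (λ f → ind (eqb (f y) v ∧ p f)))
      ≡⟨ sum-swap (allFin r) F _ ⟩
    ∑ F (λ f → ∑ (allFin r) (λ v → ind (eqb (f y) v ∧ p f)))
      ≡⟨ sum-cong F (λ f → sum-cong (allFin r) (λ v → trans (ind-∧ (eqb (f y) v) (p f)) (*-comm _ (ind (p f))))) ⟩
    ∑ F (λ f → ∑ (allFin r) (λ v → ind (p f) * ind (eqb (f y) v)))
      ≡⟨ sum-cong F (λ f → sum-*ˡ (ind (p f)) (allFin r) _) ⟩
    ∑ F (λ f → ind (p f) * ∑ (allFin r) (ind ∘ eqb (f y)))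
      ≡⟨ sum-cong F (λ f → trans (cong (ind (p f) *_) (exactlyOne-eqb (f y))) (*-identityʳ _)) ⟩
    ∑ F (ind ∘ p)
      ≡⟨ count≡sum p F ⟨
    count p F ∎)
  where open ≡-Reasoning

valueAt : {n r : ℕ} → Fin n → Assignment n r → Maybe (Fin r)
valueAt x [] = nothing
valueAt x ((p , v) ∷ ps) with x ≟ p
... | yes _ = just v
... | no _  = valueAt x ps

valueAt-just : {n r : ℕ} (x : Fin n) (ps : Assignment n r) {u : Fin r} → valueAt x ps ≡ just u →
               (f : Fin n → Fin r) → fits ps f ≡ true → f x ≡ u
valueAt-just x ((p , v) ∷ ps) e f fits-f with x ≟ p
valueAt-just x ((p , v) ∷ ps) refl f fits-f | yes refl = eqb-sound _ _ (proj₁ (∧≡true _ _ fits-f))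
... | no _ = valueAt-just x ps e f (proj₂ (∧≡true _ _ fits-f))

valueAt-nothing : {n r : ℕ} (x : Fin n) (ps : Assignment n r) → valueAt x ps ≡ nothing → All (x ≢_) (points ps)
valueAt-nothing x [] e = []
valueAt-nothing x ((p , v) ∷ ps) e with x ≟ p
valueAt-nothing x ((p , v) ∷ ps) () | yes _
... | no x≢p = x≢p ∷ valueAt-nothing x ps e

module _ {n r : ℕ} (F : List (Fin n → Fin r)) where

  -- Splitting by the value v of f at the fresh point y, only the single v with E v survives.
  count-fresh-point : (y : Fin n) (E : Fin r → Bool) → ExactlyOne E →
    (ps : Assignment n r) (C : (Fin n → Fin r) → Bool) (j : ℕ) →
    (∀ v → count (λ f → fits ((y , v) ∷ ps) f ∧ C f) F * r ^ (suc (length ps) + j) ≡ length F) →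
    count (λ f → fits ps f ∧ (E (f y) ∧ C f)) F * r ^ (length ps + suc j) ≡ length F
  count-fresh-point y E one ps C j fixed = begin
      count (λ f → fits ps f ∧ (E (f y) ∧ C f)) F * R
        ≡⟨ cong (_* R) (count-by-value y _ F) ⟩
      ∑ (allFin r) (λ v → count (λ f → eqb (f y) v ∧ (fits ps f ∧ (E (f y) ∧ C f))) F) * R
        ≡⟨ cong (_* R) (sum-cong (allFin r) (λ v →
             trans (count-cong F (λ f → pull-out (f y) v (fits ps f) (C f))) (count-const∧ (E v) _ F))) ⟩
      ∑ (allFin r) (λ v → ind (E v) * N v) * R
        ≡⟨ sum-*ʳ R (allFin r) _ ⟨
      ∑ (allFin r) (λ v → ind (E v) * N v * R)
        ≡⟨ sum-cong (allFin r) (λ v → trans (*-assoc (ind (E v)) _ R)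
             (cong (ind (E v) *_) (trans (cong (N v *_) (cong (r ^_) (+-suc (length ps) j))) (fixed v)))) ⟩
      ∑ (allFin r) (λ v → ind (E v) * length F)
        ≡⟨ sum-*ʳ (length F) (allFin r) _ ⟩
      ∑ (allFin r) (ind ∘ E) * length F
        ≡⟨ cong (_* length F) one ⟩
      1 * length F
        ≡⟨ *-identityˡ _ ⟩
      length F ∎
    where
    open ≡-Reasoning
    R = r ^ (length ps + suc j)
    N = λ v → count (λ f → fits ((y , v) ∷ ps) f ∧ C f) F
    pull-out : (a v : Fin r) (H c : Bool) → eqb a v ∧ (H ∧ (E a ∧ c)) ≡ E v ∧ ((eqb a v ∧ H) ∧ c)
    pull-out a v H c with a ≟ v
    ... | no _     = sym (∧-zeroʳ (E v))
    ... | yes refl with E a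
    ...   | true  = refl
    ...   | false = ∧-zeroʳ H

linked : {n r : ℕ} → (Fin n → Fin n → Fin r → Fin r → Bool) → List (Fin n × Fin n) → (Fin n → Fin r) → Bool
linked ρ ls f = all (λ l → ρ (proj₁ l) (proj₂ l) (f (proj₁ l)) (f (proj₂ l))) ls

FreshLinks : {n : ℕ} → List (Fin n) → List (Fin n × Fin n) → Set
FreshLinks S []             = ⊤
FreshLinks S ((x , y) ∷ ls) = y ∉ S × x ≢ y × FreshLinks (x ∷ y ∷ S) ls

one-new-point : ∀ a b → suc a + 2 * b ≤ a + 2 * suc b
one-new-point a b = ≤-trans (n≤1+n _) (≤-reflexive (sym (budget a b)))
  where
  budget : ∀ a b → a + 2 * suc b ≡ suc (suc a + 2 * b)
  budget = solve-∀

two-new-points : ∀ a b → suc (suc a) + 2 * b ≤ a + 2 * suc b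
two-new-points a b = ≤-reflexive (budget a b)
  where
  budget : ∀ a b → suc (suc a) + 2 * b ≡ a + 2 * suc b
  budget = solve-∀

-- Each link fixes at most two new points and divides the count by r; an already fixed
-- source x is read off the assignment, a free one is split over its r values.
module _ {n r κ : ℕ} .{{_ : NonZero r}} (F : List (Fin n → Fin r)) (independent : Independent n κ r F)
         (ρ : Fin n → Fin n → Fin r → Fin r → Bool) (ρ-one : ∀ x y u → ExactlyOne (ρ x y u)) where

  count-linked : (ls : List (Fin n × Fin n)) (S : List (Fin n)) (ps : Assignment n r) →
    Unique (points ps) → (∀ {q} → q ∈ points ps → q ∈ S) → FreshLinks S ls →
    length ps + 2 * length ls ≤ κ →
    count (λ f → fits ps f ∧ linked ρ ls f) F * r ^ (length ps + length ls) ≡ length F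
  count-linked [] S ps unique used _ ps≤κ =
    trans (cong₂ _*_ (count-cong F (λ f → ∧-identityʳ (fits ps f))) (cong (r ^_) (+-identityʳ (length ps))))
          (independent ps unique (≤-trans (≤-reflexive (sym (+-identityʳ _))) ps≤κ))
  count-linked ((x , y) ∷ ls) S ps unique used (y∉S , x≢y , fresh) budget with valueAt x ps in eq
  ... | just u =
    trans (cong (_* r ^ (length ps + suc (length ls)))
            (count-cong F (λ f → read-source (fits ps f) (f x) (f y) (linked ρ ls f) (valueAt-just x ps eq f))))
    (count-fresh-point F y (ρ x y u) (ρ-one x y u) ps (linked ρ ls) (length ls) (λ v →
      count-linked ls (x ∷ y ∷ S) ((y , v) ∷ ps) (y∉ps ∷ unique) (used-y {v}) fresh
        (≤-trans (one-new-point (length ps) (length ls)) budget)))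
    where
    read-source : (H : Bool) (a b : Fin r) (c : Bool) → (H ≡ true → a ≡ u) →
                  H ∧ (ρ x y a b ∧ c) ≡ H ∧ (ρ x y u b ∧ c)
    read-source false a b c a≡u = refl
    read-source true  a b c a≡u rewrite a≡u refl = refl
    y∉ps : All (y ≢_) (points ps)
    y∉ps = ¬Any⇒All¬ (points ps) (y∉S ∘ used)
    used-y : ∀ {v q} → q ∈ points ((y , v) ∷ ps) → q ∈ x ∷ y ∷ S
    used-y (here q≡y)  = there (here q≡y)
    used-y (there q∈ps) = there (there (used q∈ps))
  ... | nothing = *-cancelˡ-≡ _ _ r (begin
      r * (count P F * R)
        ≡⟨ *-assoc r _ _ ⟨
      r * count P F * R
        ≡⟨ cong (_* R) (*-comm r _) ⟩
      count P F * r * R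
        ≡⟨ *-assoc (count P F) r R ⟩
      count P F * (r * R)
        ≡⟨ cong (_* (r * R)) (count-by-value x P F) ⟩
      ∑ (allFin r) (λ u → count (λ f → eqb (f x) u ∧ P f) F) * (r * R)
        ≡⟨ sum-*ʳ (r * R) (allFin r) _ ⟨
      ∑ (allFin r) (λ u → count (λ f → eqb (f x) u ∧ P f) F * (r * R))
        ≡⟨ sum-cong (allFin r) (λ u → cong (_* (r * R))
             (count-cong F (λ f → fix-source (f x) u (fits ps f) (linked ρ ls f) (f y)))) ⟩
      ∑ (allFin r) (λ u → count (λ f → fits ((x , u) ∷ ps) f ∧ (ρ x y u (f y) ∧ linked ρ ls f)) F
                           * r ^ (length ((x , u) ∷ ps) + suc (length ls)))
        ≡⟨ sum-cong (allFin r) (λ u →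
             count-fresh-point F y (ρ x y u) (ρ-one x y u) ((x , u) ∷ ps) (linked ρ ls) (length ls) (λ v →
               count-linked ls (x ∷ y ∷ S) ((y , v) ∷ (x , u) ∷ ps)
                 (((x≢y ∘ sym) ∷ y∉ps) ∷ x∉ps ∷ unique) (used-xy {u} {v}) fresh
                 (≤-trans (two-new-points (length ps) (length ls)) budget))) ⟩
      ∑ (allFin r) (λ _ → length F)
        ≡⟨ sum-const (allFin r) (length F) ⟩
      length (allFin r) * length F
        ≡⟨ cong (_* length F) (length-allFin r) ⟩
      r * length F ∎)
    where
    open ≡-Reasoning
    P = λ f → fits ps f ∧ (ρ x y (f x) (f y) ∧ linked ρ ls f)
    R = r ^ (length ps + suc (length ls))
    fix-source : (a u : Fin r) (H c : Bool) (b : Fin r) →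
                 eqb a u ∧ (H ∧ (ρ x y a b ∧ c)) ≡ (eqb a u ∧ H) ∧ (ρ x y u b ∧ c)
    fix-source a u H c b with a ≟ u
    ... | yes refl = refl
    ... | no _     = refl
    x∉ps : All (x ≢_) (points ps)
    x∉ps = valueAt-nothing x ps eq
    y∉ps : All (y ≢_) (points ps)
    y∉ps = ¬Any⇒All¬ (points ps) (y∉S ∘ used)
    used-xy : ∀ {u v q} → q ∈ points ((y , v) ∷ (x , u) ∷ ps) → q ∈ x ∷ y ∷ S
    used-xy (here q≡y)          = there (here q≡y)
    used-xy (there (here q≡x))  = here q≡x
    used-xy (there (there q∈ps)) = there (there (used q∈ps))

length-vecsOver : {A : Set} (xs : List A) (c : ℕ) → length (vecsOver xs c) ≡ length xs ^ c
length-vecsOver xs zero    = refl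
length-vecsOver xs (suc c) = trans (length-concatMap _ xs)
  (trans (sum-cong xs (λ x → trans (LP.length-map (x ∷ᵥ_) (vecsOver xs c)) (length-vecsOver xs c)))
         (sum-const xs _))

sum-vecsOver-suc : {A : Set} (xs : List A) (c : ℕ) (w : Vec A (suc c) → ℕ) →
                   ∑ (vecsOver xs (suc c)) w ≡ ∑ xs (λ x → ∑ (vecsOver xs c) (λ z → w (x ∷ᵥ z)))
sum-vecsOver-suc xs c w =
  trans (sum-concatMap _ xs w) (sum-cong xs (λ x → sum-map (x ∷ᵥ_) (vecsOver xs c) w))

module _ {m : ℕ} where

  splitHead : {ℓ : ℕ} → Assignment (suc ℓ) m → Maybe (Fin m) × Assignment ℓ m
  splitHead []                = nothing , []
  splitHead ((fz , v) ∷ ps)   = just v , proj₂ (splitHead ps)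
  splitHead ((fs p , v) ∷ ps) = proj₁ (splitHead ps) , (p , v) ∷ proj₂ (splitHead ps)

  fitsHead : Maybe (Fin m) → Fin m → Bool
  fitsHead nothing  t = true
  fitsHead (just v) t = eqb t v

  sizeHead : Maybe (Fin m) → ℕ
  sizeHead nothing  = 0
  sizeHead (just _) = 1

  splitHead-nothing : {ℓ : ℕ} (ps : Assignment (suc ℓ) m) → All (fz ≢_) (points ps) →
                      proj₁ (splitHead ps) ≡ nothing
  splitHead-nothing []                _               = refl
  splitHead-nothing ((fz , v) ∷ ps)   (fz≢fz ∷ _)     = ⊥-elim (fz≢fz refl)
  splitHead-nothing ((fs p , v) ∷ ps) (_ ∷ fz∉ps)     = splitHead-nothing ps fz∉ps

  fits-splitHead : {ℓ : ℕ} (ps : Assignment (suc ℓ) m) → Unique (points ps) → (t : Fin m) (z : Vec (Fin m) ℓ) →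
    fits ps (Vec.lookup (t ∷ᵥ z)) ≡ fitsHead (proj₁ (splitHead ps)) t ∧ fits (proj₂ (splitHead ps)) (Vec.lookup z)
  fits-splitHead [] u t z = refl
  fits-splitHead ((fz , v) ∷ ps) (fz∉ps ∷ u) t z
    rewrite fits-splitHead ps u t z | splitHead-nothing ps fz∉ps = refl
  fits-splitHead ((fs p , v) ∷ ps) (_ ∷ u) t z
    rewrite fits-splitHead ps u t z with eqb (Vec.lookup z p) v | fitsHead (proj₁ (splitHead ps)) t
  ... | true  | _     = refl
  ... | false | true  = refl
  ... | false | false = refl

  splitHead-∉ : {ℓ : ℕ} (q : Fin ℓ) (ps : Assignment (suc ℓ) m) → All (fs q ≢_) (points ps) →
                All (q ≢_) (points (proj₂ (splitHead ps)))
  splitHead-∉ q []                _              = []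
  splitHead-∉ q ((fz , v) ∷ ps)   (_ ∷ q∉ps)     = splitHead-∉ q ps q∉ps
  splitHead-∉ q ((fs p , v) ∷ ps) (q≢p ∷ q∉ps)   = (q≢p ∘ cong fs) ∷ splitHead-∉ q ps q∉ps

  splitHead-unique : {ℓ : ℕ} (ps : Assignment (suc ℓ) m) → Unique (points ps) →
                     Unique (points (proj₂ (splitHead ps)))
  splitHead-unique []                u            = []
  splitHead-unique ((fz , v) ∷ ps)   (_ ∷ u)      = splitHead-unique ps u
  splitHead-unique ((fs p , v) ∷ ps) (p∉ps ∷ u)   = splitHead-∉ p ps p∉ps ∷ splitHead-unique ps u

  splitHead-length : {ℓ : ℕ} (ps : Assignment (suc ℓ) m) → Unique (points ps) →
                     length ps ≡ sizeHead (proj₁ (splitHead ps)) + length (proj₂ (splitHead ps))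
  splitHead-length [] u = refl
  splitHead-length ((fz , v) ∷ ps) (fz∉ps ∷ u)
    rewrite splitHead-length ps u | splitHead-nothing ps fz∉ps = refl
  splitHead-length ((fs p , v) ∷ ps) (_ ∷ u)
    rewrite splitHead-length ps u = sym (+-suc (sizeHead (proj₁ (splitHead ps))) _)

  count-head : (h : Maybe (Fin m)) (c L L′ : ℕ) → L ≡ sizeHead h + L′ →
               ∑ (allFin m) (ind ∘ fitsHead h) * c * m ^ L ≡ m * (c * m ^ L′)
  count-head nothing c L L′ refl = begin
      ∑ (allFin m) (λ _ → 1) * c * m ^ L′  ≡⟨ cong (λ x → x * c * m ^ L′) (sum-const (allFin m) 1) ⟩
      length (allFin m) * 1 * c * m ^ L′   ≡⟨ cong (λ x → x * c * m ^ L′) (trans (*-identityʳ _) (length-allFin m)) ⟩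
      m * c * m ^ L′                       ≡⟨ *-assoc m c _ ⟩
      m * (c * m ^ L′)                     ∎
    where open ≡-Reasoning
  count-head (just v) c L L′ refl = begin
      ∑ (allFin m) (λ t → ind (eqb t v)) * c * m ^ (1 + L′)  ≡⟨ cong (λ x → x * c * m ^ (1 + L′)) (exactlyOne-eqbʳ v) ⟩
      1 * c * (m * m ^ L′)                                  ≡⟨ rearrange c m (m ^ L′) ⟩
      m * (c * m ^ L′)                                      ∎
    where
    open ≡-Reasoning
    rearrange : ∀ c m p → 1 * c * (m * p) ≡ m * (c * p)
    rearrange = solve-∀

  count-vectors-fitting : (ℓ : ℕ) (ps : Assignment ℓ m) → Unique (points ps) →
    count (fits ps ∘ Vec.lookup) (vecsOver (allFin m) ℓ) * m ^ length ps ≡ m ^ ℓ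
  count-vectors-fitting zero    []              u = refl
  count-vectors-fitting zero    ((() , v) ∷ ps) u
  count-vectors-fitting (suc ℓ) ps              u = begin
      count (fits ps ∘ Vec.lookup) (vecsOver (allFin m) (suc ℓ)) * K
        ≡⟨ cong (_* K) (trans (count≡sum _ (vecsOver (allFin m) (suc ℓ))) (sum-vecsOver-suc (allFin m) ℓ _)) ⟩
      ∑ (allFin m) (λ t → ∑ Z (λ z → ind (fits ps (Vec.lookup (t ∷ᵥ z))))) * K
        ≡⟨ cong (_* K) (sum-cong (allFin m) (λ t → begin
             ∑ Z (λ z → ind (fits ps (Vec.lookup (t ∷ᵥ z))))
               ≡⟨ sum-cong Z (λ z → cong ind (fits-splitHead ps u t z)) ⟩
             ∑ Z (λ z → ind (fitsHead h t ∧ fits ps′ (Vec.lookup z)))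
               ≡⟨ count≡sum _ Z ⟨
             count (λ z → fitsHead h t ∧ fits ps′ (Vec.lookup z)) Z
               ≡⟨ count-const∧ (fitsHead h t) _ Z ⟩
             ind (fitsHead h t) * c ∎)) ⟩
      ∑ (allFin m) (λ t → ind (fitsHead h t) * c) * K
        ≡⟨ cong (_* K) (sum-*ʳ c (allFin m) (ind ∘ fitsHead h)) ⟩
      ∑ (allFin m) (ind ∘ fitsHead h) * c * K
        ≡⟨ count-head h c (length ps) (length ps′) (splitHead-length ps u) ⟩
      m * (c * m ^ length ps′)
        ≡⟨ cong (m *_) (count-vectors-fitting ℓ ps′ (splitHead-unique ps u)) ⟩
      m ^ suc ℓ ∎
    where
    open ≡-Reasoning
    K = m ^ length ps
    Z = vecsOver (allFin m) ℓ
    h = proj₁ (splitHead ps)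
    ps′ = proj₂ (splitHead ps)
    c = count (fits ps′ ∘ Vec.lookup) Z

Unique-⊆⇒length≤ : {A : Set} (xs : List A) {ys : List A} → Unique xs → (∀ {a} → a ∈ xs → a ∈ ys) →
                   length xs ≤ length ys
Unique-⊆⇒length≤ []       _            _   = z≤n
Unique-⊆⇒length≤ (x ∷ xs) (x∉xs ∷ u) xs⊆ys with ∈-∃++ (xs⊆ys (here refl))
... | ys₁ , ys₂ , refl = begin
    suc (length xs)           ≤⟨ s≤s (Unique-⊆⇒length≤ xs u xs⊆ys₁++ys₂) ⟩
    suc (length (ys₁ ++ ys₂)) ≡⟨ cong suc (LP.length-++ ys₁) ⟩
    suc (length ys₁ + length ys₂) ≡⟨ +-suc (length ys₁) (length ys₂) ⟨
    length ys₁ + length (x ∷ ys₂) ≡⟨ LP.length-++ ys₁ ⟨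
    length (ys₁ ++ x ∷ ys₂)   ∎
  where
  open ≤-Reasoning
  xs⊆ys₁++ys₂ : ∀ {a} → a ∈ xs → a ∈ ys₁ ++ ys₂
  xs⊆ys₁++ys₂ a∈xs with ∈-++⁻ ys₁ (xs⊆ys (there a∈xs))
  ... | inj₁ a∈ys₁         = ∈-++⁺ˡ a∈ys₁
  ... | inj₂ (here refl)   = ⊥-elim (All¬⇒¬Any x∉xs a∈xs)
  ... | inj₂ (there a∈ys₂) = ∈-++⁺ʳ ys₁ a∈ys₂

elements : {n : ℕ} → Subset n → List (Fin n)
elements []ᵥ          = []
elements (true ∷ᵥ T)  = fz ∷ List.map fs (elements T)
elements (false ∷ᵥ T) = List.map fs (elements T)

length-elements : {n : ℕ} (T : Subset n) → length (elements T) ≡ ∣ T ∣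
length-elements []ᵥ          = refl
length-elements (true ∷ᵥ T)  = cong suc (trans (LP.length-map fs (elements T)) (length-elements T))
length-elements (false ∷ᵥ T) = trans (LP.length-map fs (elements T)) (length-elements T)

fz∉map-fs : {n : ℕ} (xs : List (Fin n)) → All (fz ≢_) (List.map fs xs)
fz∉map-fs []       = []
fz∉map-fs (x ∷ xs) = (λ ()) ∷ fz∉map-fs xs

elements-unique : {n : ℕ} (T : Subset n) → Unique (elements T)
elements-unique []ᵥ          = []
elements-unique (true ∷ᵥ T)  = fz∉map-fs (elements T) ∷ Unique.map⁺ fs-injective (elements-unique T)
elements-unique (false ∷ᵥ T) = Unique.map⁺ fs-injective (elements-unique T)

elements-sound : {n : ℕ} (T : Subset n) {x : Fin n} → x ∈ elements T → Vec.lookup T x ≡ true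
elements-sound (true ∷ᵥ T) (here refl) = refl
elements-sound (true ∷ᵥ T) (there x∈T) with ∈-map⁻ fs x∈T
... | y , y∈T , refl = elements-sound T y∈T
elements-sound (false ∷ᵥ T) x∈T with ∈-map⁻ fs x∈T
... | y , y∈T , refl = elements-sound T y∈T

elements-complete : {n : ℕ} (T : Subset n) (x : Fin n) → Vec.lookup T x ≡ true → x ∈ elements T
elements-complete (true ∷ᵥ T)  fz     e = here refl
elements-complete (true ∷ᵥ T)  (fs x) e = there (∈-map⁺ fs (elements-complete T x e))
elements-complete (false ∷ᵥ T) (fs x) e = ∈-map⁺ fs (elements-complete T x e)

all-map : {A B : Set} (f : A → B) (P : B → Bool) (xs : List A) → all P (List.map f xs) ≡ all (P ∘ f) xs
all-map f P []       = refl
all-map f P (x ∷ xs) = cong (P (f x) ∧_) (all-map f P xs)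

all-cong : {A : Set} (xs : List A) {p q : A → Bool} → (∀ x → p x ≡ q x) → all p xs ≡ all q xs
all-cong []       e = refl
all-cong (x ∷ xs) e = cong₂ _∧_ (e x) (all-cong xs e)

all-∧ : {A : Set} (p q : A → Bool) (xs : List A) → all (λ x → p x ∧ q x) xs ≡ all p xs ∧ all q xs
all-∧ p q []       = refl
all-∧ p q (x ∷ xs) rewrite all-∧ p q xs with p x | q x
... | true  | true  = refl
... | true  | false = sym (∧-zeroʳ (all p xs))
... | false | _     = refl

all-intro : {A : Set} (P : A → Bool) (xs : List A) → (∀ x → x ∈ xs → P x ≡ true) → all P xs ≡ true
all-intro P []       h = refl
all-intro P (x ∷ xs) h rewrite h x (here refl) = all-intro P xs (λ y y∈xs → h y (there y∈xs))

all-elements : {n : ℕ} (T : Subset n) (P : Fin n → Bool) →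
               all (λ x → not (Vec.lookup T x) ∨ P x) (allFin n) ≡ all P (elements T)
all-elements []ᵥ P = refl
all-elements {suc n} (true ∷ᵥ T) P =
  cong (P fz ∧_) (trans (all-tabulate n fs _) (trans (all-elements T (P ∘ fs)) (sym (all-map fs P (elements T)))))
all-elements {suc n} (false ∷ᵥ T) P =
  trans (all-tabulate n fs _) (trans (all-elements T (P ∘ fs)) (sym (all-map fs P (elements T))))

any-sound : {A : Set} (p : A → Bool) (xs : List A) → any p xs ≡ true → ∃ λ x → x ∈ xs × p x ≡ true
any-sound p (x ∷ xs) e with p x in px
... | true  = x , here refl , px
... | false with any-sound p xs e
...   | y , y∈xs , py = y , there y∈xs , py

any-complete : {A : Set} (p : A → Bool) {xs : List A} {x : A} → x ∈ xs → p x ≡ true → any p xs ≡ true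
any-complete p {y ∷ ys} (here refl) px rewrite px = refl
any-complete p {y ∷ ys} (there x∈ys) px rewrite any-complete p x∈ys px = ∨-zeroʳ (p y)

module _ {n ℓ : ℕ} (g : Fin n → Fin ℓ) (T : Subset n) where

  image-sound : (v : Fin ℓ) → Vec.lookup (image g T) v ≡ true → ∃ λ x → Vec.lookup T x ≡ true × g x ≡ v
  image-sound v e with any-sound _ (allFin n) (trans (sym (VP.lookup∘tabulate _ v)) e)
  ... | x , _ , Tx∧gx≡v with Vec.lookup T x in Tx
  ... | true = x , Tx , eqb-sound _ _ Tx∧gx≡v

  image-complete : (x : Fin n) → Vec.lookup T x ≡ true → Vec.lookup (image g T) (g x) ≡ true
  image-complete x e =
    trans (VP.lookup∘tabulate _ (g x)) (any-complete _ (∈-allFin x) (cong₂ _∧_ e (eqb-refl (g x))))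

  ∣image∣≤ : (L : List (Fin ℓ)) → (∀ x → x ∈ elements T → g x ∈ L) → ∣ image g T ∣ ≤ length L
  ∣image∣≤ L g[T]⊆L = begin
    ∣ image g T ∣                 ≡⟨ length-elements (image g T) ⟨
    length (elements (image g T)) ≤⟨ Unique-⊆⇒length≤ _ (elements-unique (image g T)) image⊆L ⟩
    length L                      ∎
    where
    open ≤-Reasoning
    image⊆L : ∀ {v} → v ∈ elements (image g T) → v ∈ L
    image⊆L {v} v∈ with image-sound v (elements-sound (image g T) v∈)
    ... | x , x∈T , refl = g[T]⊆L x (elements-complete T x x∈T)

  ≤∣image∣ : (L : List (Fin ℓ)) → Unique L → (∀ v → v ∈ L → ∃ λ x → x ∈ elements T × g x ≡ v) →
             length L ≤ ∣ image g T ∣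
  ≤∣image∣ L u L⊆g[T] = begin
    length L                      ≤⟨ Unique-⊆⇒length≤ L u L⊆image ⟩
    length (elements (image g T)) ≡⟨ length-elements (image g T) ⟩
    ∣ image g T ∣                 ∎
    where
    open ≤-Reasoning
    L⊆image : ∀ {v} → v ∈ L → v ∈ elements (image g T)
    L⊆image {v} v∈L with L⊆g[T] v v∈L
    ... | x , x∈T , refl = elements-complete (image g T) (g x) (image-complete x (elements-sound T x∈T))

module Representatives {n ℓ : ℕ} (g : Fin n → Fin ℓ) where

  representative : List (Fin n) → Fin n → Maybe (Fin n)
  representative []      x = nothing
  representative (s ∷ S) x = if eqb (g s) (g x) then just s else representative S x

  representative-just : (S : List (Fin n)) (x r : Fin n) → representative S x ≡ just r → r ∈ S × g r ≡ g x
  representative-just (s ∷ S) x r e with eqb (g s) (g x) in gs≡gx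
  representative-just (s ∷ S) x r refl | true = here refl , eqb-sound _ _ gs≡gx
  ... | false = let (r∈S , gr≡gx) = representative-just S x r e in there r∈S , gr≡gx

  representative-nothing : (S : List (Fin n)) (x : Fin n) → representative S x ≡ nothing →
                           g x ∉ List.map g S
  representative-nothing (s ∷ S) x e gx∈ with eqb (g s) (g x) in gs≡gx
  representative-nothing (s ∷ S) x () gx∈ | true
  representative-nothing (s ∷ S) x e (here gx≡gs) | false =
    true≢false (subst (λ v → eqb (g s) v ≡ true) (sym gx≡gs) (eqb-refl (g s))) gs≡gx
  representative-nothing (s ∷ S) x e (there gx∈) | false = representative-nothing S x e gx∈

  split : List (Fin n) → List (Fin n) → List (Fin n) × List (Fin n × Fin n)
  split S []       = [] , []
  split S (x ∷ xs) with representative S x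
  ... | just r  = proj₁ (split S xs) , (r , x) ∷ proj₂ (split S xs)
  ... | nothing = x ∷ proj₁ (split (x ∷ S) xs) , proj₂ (split (x ∷ S) xs)

  reps : List (Fin n) → List (Fin n) → List (Fin n)
  reps S xs = proj₁ (split S xs)

  links : List (Fin n) → List (Fin n) → List (Fin n × Fin n)
  links S xs = proj₂ (split S xs)

  length-split : (S xs : List (Fin n)) → length (reps S xs) + length (links S xs) ≡ length xs
  length-split S []       = refl
  length-split S (x ∷ xs) with representative S x
  ... | just r  = trans (+-suc (length (reps S xs)) _) (cong suc (length-split S xs))
  ... | nothing = cong suc (length-split (x ∷ S) xs)

  reps-cover : (S xs : List (Fin n)) (x : Fin n) → x ∈ xs →
               ∃ λ r → (r ∈ S ⊎ r ∈ reps S xs) × g r ≡ g x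
  reps-cover S (x ∷ xs) x′ x′∈ with representative S x in eq
  reps-cover S (x ∷ xs) x′ (here refl)  | just r = r , inj₁ (proj₁ (representative-just S x r eq)) ,
                                                       proj₂ (representative-just S x r eq)
  reps-cover S (x ∷ xs) x′ (there x′∈)  | just r = reps-cover S xs x′ x′∈
  reps-cover S (x ∷ xs) x′ (here refl)  | nothing = x , inj₂ (here refl) , refl
  reps-cover S (x ∷ xs) x′ (there x′∈)  | nothing with reps-cover (x ∷ S) xs x′ x′∈
  ... | r , inj₁ (here refl) , gr≡gx′ = r , inj₂ (here refl) , gr≡gx′
  ... | r , inj₁ (there r∈S) , gr≡gx′ = r , inj₁ r∈S , gr≡gx′
  ... | r , inj₂ r∈R , gr≡gx′         = r , inj₂ (there r∈R) , gr≡gx′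

  reps⊆ : (S xs : List (Fin n)) (r : Fin n) → r ∈ reps S xs → r ∈ xs
  reps⊆ S (x ∷ xs) r r∈ with representative S x
  ... | just _ = there (reps⊆ S xs r r∈)
  reps⊆ S (x ∷ xs) r (here refl) | nothing = here refl
  reps⊆ S (x ∷ xs) r (there r∈)  | nothing = there (reps⊆ (x ∷ S) xs r r∈)

  reps-unique : (S xs : List (Fin n)) → Unique (List.map g S) →
                Unique (List.map g (reps S xs)) × (∀ r → r ∈ reps S xs → g r ∉ List.map g S)
  reps-unique S []       u = [] , λ r ()
  reps-unique S (x ∷ xs) u with representative S x in eq
  ... | just _  = reps-unique S xs u
  ... | nothing =
    let gx∉gS        = representative-nothing S x eq
        (u′ , new)   = reps-unique (x ∷ S) xs (¬Any⇒All¬ _ gx∉gS ∷ u)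
    in (¬Any⇒All¬ _ (λ gx∈gR → let (r , r∈R , gx≡gr) = ∈-map⁻ g gx∈gR in new r r∈R (here (sym gx≡gr))) ∷ u′) ,
       λ { r (here refl) → gx∉gS ; r (there r∈R) gr∈gS → new r r∈R (there gr∈gS) }

  links-sound : (S xs : List (Fin n)) (r y : Fin n) → (r , y) ∈ links S xs →
                (r ∈ S ⊎ r ∈ xs) × y ∈ xs × g r ≡ g y
  links-sound S (x ∷ xs) r y l∈ with representative S x in eq
  links-sound S (x ∷ xs) r y (here refl) | just r′ =
    inj₁ (proj₁ (representative-just S x r′ eq)) , here refl , proj₂ (representative-just S x r′ eq)
  links-sound S (x ∷ xs) r y (there l∈) | just r′ with links-sound S xs r y l∈
  ... | inj₁ r∈S , y∈ , gr≡gy = inj₁ r∈S , there y∈ , gr≡gy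
  ... | inj₂ r∈  , y∈ , gr≡gy = inj₂ (there r∈) , there y∈ , gr≡gy
  links-sound S (x ∷ xs) r y l∈ | nothing with links-sound (x ∷ S) xs r y l∈
  ... | inj₁ (here refl) , y∈ , gr≡gy = inj₂ (here refl) , there y∈ , gr≡gy
  ... | inj₁ (there r∈S) , y∈ , gr≡gy = inj₁ r∈S , there y∈ , gr≡gy
  ... | inj₂ r∈          , y∈ , gr≡gy = inj₂ (there r∈) , there y∈ , gr≡gy

  links-fresh : (S S′ xs : List (Fin n)) → Unique xs → (∀ x → x ∈ xs → x ∉ S′) → (∀ x → x ∈ xs → x ∉ S) →
                FreshLinks S′ (links S xs)
  links-fresh S S′ []       u          xs#S′ xs#S = tt
  links-fresh S S′ (x ∷ xs) (x∉xs ∷ u) xs#S′ xs#S with representative S x in eq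
  ... | just r =
    xs#S′ x (here refl) ,
    (λ r≡x → xs#S x (here refl) (subst (_∈ S) r≡x r∈S)) ,
    links-fresh S (r ∷ x ∷ S′) xs u
      (λ { x′ x′∈ (here refl)          → xs#S x′ (there x′∈) r∈S
         ; x′ x′∈ (there (here refl))  → All¬⇒¬Any x∉xs x′∈
         ; x′ x′∈ (there (there x′∈S′)) → xs#S′ x′ (there x′∈) x′∈S′ })
      (λ x′ x′∈ → xs#S x′ (there x′∈))
    where r∈S = proj₁ (representative-just S x r eq)
  ... | nothing =
    links-fresh (x ∷ S) S′ xs u (λ x′ x′∈ → xs#S′ x′ (there x′∈))
      (λ { x′ x′∈ (here refl) → All¬⇒¬Any x∉xs x′∈ ; x′ x′∈ (there x′∈S) → xs#S x′ (there x′∈) x′∈S })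

-- One round of the hash: z[g x] + f x is uniform on T when g has few collisions on T

module _ {n ℓ : ℕ} (g : Fin n → Fin ℓ) (T : Subset n) where
  open Representatives g

  length-reps : length (reps [] (elements T)) ≡ ∣ image g T ∣
  length-reps = ≤-antisym
    (begin
      length R            ≡⟨ LP.length-map g R ⟨
      length (List.map g R) ≤⟨ ≤∣image∣ g T (List.map g R) (proj₁ (reps-unique [] (elements T) []))
                                (λ v v∈ → let (r , r∈R , v≡gr) = ∈-map⁻ g v∈
                                          in r , reps⊆ [] (elements T) r r∈R , sym v≡gr) ⟩
      ∣ image g T ∣       ∎)
    (begin
      ∣ image g T ∣         ≤⟨ ∣image∣≤ g T (List.map g R) g[T]⊆g[R] ⟩
      length (List.map g R) ≡⟨ LP.length-map g R ⟩
      length R              ∎)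
    where
    open ≤-Reasoning
    R = reps [] (elements T)
    g[T]⊆g[R] : ∀ x → x ∈ elements T → g x ∈ List.map g R
    g[T]⊆g[R] x x∈T with reps-cover [] (elements T) x x∈T
    ... | r , inj₂ r∈R , gr≡gx = subst (_∈ List.map g R) gr≡gx (∈-map⁺ g r∈R)

  length-reps+links : length (reps [] (elements T)) + length (links [] (elements T)) ≡ ∣ T ∣
  length-reps+links = trans (length-split [] (elements T)) (length-elements T)

  length-links≤ : (k : ℕ) → ∣ T ∣ ≤ k + ∣ image g T ∣ → length (links [] (elements T)) ≤ k
  length-links≤ k T≤k+gT = +-cancelˡ-≤ (length R) _ _ (begin
      length R + length N ≡⟨ length-reps+links ⟩
      ∣ T ∣               ≤⟨ T≤k+gT ⟩
      k + ∣ image g T ∣   ≡⟨ cong (k +_) length-reps ⟨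
      k + length R        ≡⟨ +-comm k (length R) ⟩
      length R + k        ∎)
    where
    open ≤-Reasoning
    R = reps [] (elements T)
    N = links [] (elements T)

  ≤length-links : (k : ℕ) → k + ∣ image g T ∣ ≤ ∣ T ∣ → k ≤ length (links [] (elements T))
  ≤length-links k k+gT≤T = +-cancelʳ-≤ (length R) k (length N) (begin
      k + length R        ≡⟨ cong (k +_) length-reps ⟩
      k + ∣ image g T ∣   ≤⟨ k+gT≤T ⟩
      ∣ T ∣               ≡⟨ length-reps+links ⟨
      length R + length N ≡⟨ +-comm (length R) (length N) ⟩
      length N + length R ∎)
    where
    open ≤-Reasoning
    R = reps [] (elements T)
    N = links [] (elements T)

module VectorsOnClasses {n ℓ : ℕ} (m : ℕ) (g : Fin n → Fin ℓ) (c : Fin n → Fin m) where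
  open Representatives g

  onCoordinates : List (Fin n) → Assignment ℓ m
  onCoordinates S = List.map (λ s → (g s , c s)) S

  points-onCoordinates : (S : List (Fin n)) → points (onCoordinates S) ≡ List.map g S
  points-onCoordinates []      = refl
  points-onCoordinates (s ∷ S) = cong (g s ∷_) (points-onCoordinates S)

  onCoordinates-sound : (S : List (Fin n)) (z : Fin ℓ → Fin m) (r : Fin n) →
                        fits (onCoordinates S) z ≡ true → r ∈ S → z (g r) ≡ c r
  onCoordinates-sound (s ∷ S) z r fits-z (here refl) = eqb-sound _ _ (proj₁ (∧≡true _ _ fits-z))
  onCoordinates-sound (s ∷ S) z r fits-z (there r∈S) = onCoordinates-sound S z r (proj₂ (∧≡true _ _ fits-z)) r∈S

  constantOnLinks : List (Fin n × Fin n) → Bool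
  constantOnLinks ls = all (λ l → eqb (c (proj₂ l)) (c (proj₁ l))) ls

  agreeOn : List (Fin n) → Vec (Fin m) ℓ → Bool
  agreeOn xs z = all (λ x → eqb (Vec.lookup z (g x)) (c x)) xs

  -- A point of xs whose class already has a representative r only adds the condition c x = c r;
  -- a new representative x fixes one more coordinate z[g x].
  count-agreeOn : (S xs : List (Fin n)) → Unique (List.map g S) →
    count (λ z → fits (onCoordinates S) (Vec.lookup z) ∧ agreeOn xs z) (vecsOver (allFin m) ℓ)
      * m ^ (length S + length (reps S xs)) ≡ m ^ ℓ * ind (constantOnLinks (links S xs))
  count-agreeOn S [] u = begin
      count (λ z → A z ∧ true) Z * m ^ (length S + 0)
        ≡⟨ cong₂ _*_ (count-cong Z (λ z → ∧-identityʳ (A z)))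
                     (cong (m ^_) (trans (+-identityʳ _) (sym (LP.length-map _ S)))) ⟩
      count (λ z → A z) Z * m ^ length (onCoordinates S)
        ≡⟨ count-vectors-fitting ℓ (onCoordinates S) (subst Unique (sym (points-onCoordinates S)) u) ⟩
      m ^ ℓ
        ≡⟨ *-identityʳ _ ⟨
      m ^ ℓ * 1 ∎
    where
    open ≡-Reasoning
    Z = vecsOver (allFin m) ℓ
    A = λ (z : Vec (Fin m) ℓ) → fits (onCoordinates S) (Vec.lookup z)
  count-agreeOn S (x ∷ xs) u with representative S x in eq
  ... | just r = begin
      count (λ z → A z ∧ (eqb (Vec.lookup z (g x)) (c x) ∧ agreeOn xs z)) Z * K
        ≡⟨ cong (_* K) (count-cong Z (λ z → known-class (A z) (agreeOn xs z) (Vec.lookup z)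
             (λ fits-z → onCoordinates-sound S (Vec.lookup z) r fits-z r∈S))) ⟩
      count (λ z → cx≡cr ∧ (A z ∧ agreeOn xs z)) Z * K
        ≡⟨ cong (_* K) (count-const∧ cx≡cr _ Z) ⟩
      ind cx≡cr * count (λ z → A z ∧ agreeOn xs z) Z * K
        ≡⟨ *-assoc (ind cx≡cr) _ K ⟩
      ind cx≡cr * (count (λ z → A z ∧ agreeOn xs z) Z * K)
        ≡⟨ cong (ind cx≡cr *_) (count-agreeOn S xs u) ⟩
      ind cx≡cr * (m ^ ℓ * ind (constantOnLinks (links S xs)))
        ≡⟨ rearrange (ind cx≡cr) (m ^ ℓ) _ ⟩
      m ^ ℓ * (ind cx≡cr * ind (constantOnLinks (links S xs)))
        ≡⟨ cong (m ^ ℓ *_) (ind-∧ cx≡cr _) ⟨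
      m ^ ℓ * ind (cx≡cr ∧ constantOnLinks (links S xs)) ∎
    where
    open ≡-Reasoning
    Z = vecsOver (allFin m) ℓ
    A = λ (z : Vec (Fin m) ℓ) → fits (onCoordinates S) (Vec.lookup z)
    K = m ^ (length S + length (reps S xs))
    r∈S = proj₁ (representative-just S x r eq)
    gr≡gx = proj₂ (representative-just S x r eq)
    cx≡cr = eqb (c x) (c r)
    known-class : (H R : Bool) (z : Fin ℓ → Fin m) → (H ≡ true → z (g r) ≡ c r) →
                  H ∧ (eqb (z (g x)) (c x) ∧ R) ≡ eqb (c x) (c r) ∧ (H ∧ R)
    known-class false R z h = sym (∧-zeroʳ _)
    known-class true  R z h rewrite sym gr≡gx | h refl = cong (_∧ R) (eqb-sym (c r) (c x))
    rearrange : ∀ a b c → a * (b * c) ≡ b * (a * c)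
    rearrange = solve-∀
  ... | nothing = begin
      count (λ z → A z ∧ (E z ∧ agreeOn xs z)) Z * m ^ (length S + suc (length (reps (x ∷ S) xs)))
        ≡⟨ cong₂ _*_ (count-cong Z (λ z → swap-∧ (A z) (E z) (agreeOn xs z))) (cong (m ^_) (+-suc (length S) _)) ⟩
      count (λ z → (E z ∧ A z) ∧ agreeOn xs z) Z * m ^ (suc (length S) + length (reps (x ∷ S) xs))
        ≡⟨ count-agreeOn (x ∷ S) xs (¬Any⇒All¬ _ (representative-nothing S x eq) ∷ u) ⟩
      m ^ ℓ * ind (constantOnLinks (links (x ∷ S) xs)) ∎
    where
    open ≡-Reasoning
    Z = vecsOver (allFin m) ℓ
    A = λ (z : Vec (Fin m) ℓ) → fits (onCoordinates S) (Vec.lookup z)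
    E = λ (z : Vec (Fin m) ℓ) → eqb (Vec.lookup z (g x)) (c x)
    swap-∧ : (a e r : Bool) → a ∧ (e ∧ r) ≡ (e ∧ a) ∧ r
    swap-∧ a e r = trans (sym (∧-assoc a e r)) (cong (_∧ r) (∧-comm a e))

module _ {n ℓ m : ℕ} .{{_ : NonZero m}} where
  open ModularArithmetic m

  sameOffset : (b : Fin n → Fin m) → Fin n → Fin n → Fin m → Fin m → Bool
  sameOffset b r y u v = eqb (subMod (b y) v) (subMod (b r) u)

  sameOffset-one : (b : Fin n → Fin m) → ∀ r y u → ExactlyOne (sameOffset b r y u)
  sameOffset-one b r y u =
    trans (sum-cong (allFin m) (λ v → cong ind (eqb-subMod (b y) v (subMod (b r) u)))) (exactlyOne-eqbʳ (subMod (b y) (subMod (b r) u)))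

  -- With c = b − f, the vectors z hitting b − f on T are counted by the representatives
  -- (count-agreeOn), and what remains is that b − f is constant along the links; there are
  -- at most k links, so 2k-wise independence of f makes that event have probability m^−|links|.
  offset-uniform : (k : ℕ) (F : List (Fin n → Fin m)) → Independent n (2 * k) m F →
    (T : Subset n) (g : Fin n → Fin ℓ) → ∣ T ∣ ≤ k + ∣ image g T ∣ → (b : Fin n → Fin m) →
    ∑ F (λ f → count (λ z → all (λ x → eqb (addMod (Vec.lookup z (g x)) (f x)) (b x)) (elements T))
                     (vecsOver (allFin m) ℓ)) * m ^ ∣ T ∣
      ≡ length F * m ^ ℓ
  offset-uniform k F independent T g T≤k+gT b = begin
      ∑ F hitting * m ^ ∣ T ∣
        ≡⟨ cong (λ e → ∑ F hitting * m ^ e) (sym (length-reps+links g T)) ⟩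
      ∑ F hitting * m ^ (length R + length N)
        ≡⟨ cong (∑ F hitting *_) (^-distribˡ-+-* m (length R) (length N)) ⟩
      ∑ F hitting * (m ^ length R * m ^ length N)
        ≡⟨ *-assoc (∑ F hitting) _ _ ⟨
      ∑ F hitting * m ^ length R * m ^ length N
        ≡⟨ cong (_* m ^ length N) (sum-*ʳ (m ^ length R) F hitting) ⟨
      ∑ F (λ f → hitting f * m ^ length R) * m ^ length N
        ≡⟨ cong (_* m ^ length N) (sum-cong F per-offset) ⟩
      ∑ F (λ f → m ^ ℓ * ind (linked (sameOffset b) N f)) * m ^ length N
        ≡⟨ cong (_* m ^ length N) (trans (sum-*ˡ (m ^ ℓ) F _) (cong (m ^ ℓ *_) (sym (count≡sum _ F)))) ⟩
      m ^ ℓ * count (linked (sameOffset b) N) F * m ^ length N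
        ≡⟨ *-assoc (m ^ ℓ) _ _ ⟩
      m ^ ℓ * (count (linked (sameOffset b) N) F * m ^ length N)
        ≡⟨ cong (m ^ ℓ *_) (count-linked F independent (sameOffset b) (sameOffset-one b) N [] [] [] (λ ())
             (Representatives.links-fresh g [] [] (elements T) (elements-unique T) (λ _ _ ()) (λ _ _ ()))
             (*-monoʳ-≤ 2 (length-links≤ g T k T≤k+gT))) ⟩
      m ^ ℓ * length F
        ≡⟨ *-comm (m ^ ℓ) (length F) ⟩
      length F * m ^ ℓ ∎
    where
    open ≡-Reasoning
    open Representatives g
    R = reps [] (elements T)
    N = links [] (elements T)
    hitting = λ (f : Fin n → Fin m) →
      count (λ z → all (λ x → eqb (addMod (Vec.lookup z (g x)) (f x)) (b x)) (elements T)) (vecsOver (allFin m) ℓ)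
    per-offset : ∀ f → hitting f * m ^ length R ≡ m ^ ℓ * ind (linked (sameOffset b) N f)
    per-offset f =
      trans (cong (_* m ^ length R) (count-cong (vecsOver (allFin m) ℓ)
              (λ z → all-cong (elements T) (λ x → eqb-addMod (Vec.lookup z (g x)) (f x) (b x)))))
            (VectorsOnClasses.count-agreeOn m g (λ x → subMod (b x) (f x)) [] (elements T) [])

fits-cong : {n r : ℕ} (ps : Assignment n r) {h h′ : Fin n → Fin r} → (∀ x → h x ≡ h′ x) → fits ps h ≡ fits ps h′
fits-cong []             e = refl
fits-cong ((p , v) ∷ ps) e = cong₂ _∧_ (cong (λ u → eqb u v) (e p)) (fits-cong ps e)

module HashFamily {n ℓ m : ℕ} .{{_ : NonZero m}} where
  open ModularArithmetic m

  Vectors : List (Vec (Fin m) ℓ)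
  Vectors = vecsOver (allFin m) ℓ

  hashFamily : {c : ℕ} → List (Fin n → Fin m) → Vec (Fin n → Fin ℓ) c → List (Fin n → Fin m)
  hashFamily {c} F gs = concatMap (λ f → List.map (λ z → hashWith f z gs) (vecsOver Vectors c)) F

  shiftBy : (Fin n → Fin m) → Vec (Fin m) ℓ → (Fin n → Fin ℓ) → Fin n → Fin m
  shiftBy f z₀ g x = addMod (f x) (Vec.lookup z₀ (g x))

  shifted : (Fin n → Fin ℓ) → List (Fin n → Fin m) → List (Fin n → Fin m)
  shifted g F = concatMap (λ f → List.map (λ z₀ → shiftBy f z₀ g) Vectors) F

  private
    Σz : {c : ℕ} → Vec (Vec (Fin m) ℓ) c → Vec (Fin n → Fin ℓ) c → Fin n → ℕ
    Σz z gs x = Vec.sum (Vec.zipWith (λ zj gj → toℕ (Vec.lookup zj (gj x))) z gs)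

  hashWith-∷ : {c : ℕ} (f : Fin n → Fin m) (z₀ : Vec (Fin m) ℓ) (z : Vec (Vec (Fin m) ℓ) c)
               (g : Fin n → Fin ℓ) (gs : Vec (Fin n → Fin ℓ) c) (x : Fin n) →
               hashWith f (z₀ ∷ᵥ z) (g ∷ᵥ gs) x ≡ hashWith (shiftBy f z₀ g) z gs x
  hashWith-∷ f z₀ z g gs x = toℕ-injective (begin
      toℕ (hashWith f (z₀ ∷ᵥ z) (g ∷ᵥ gs) x)                      ≡⟨ toℕ-mod _ ⟩
      (toℕ (f x) + (toℕ (Vec.lookup z₀ (g x)) + Σz z gs x)) % m   ≡⟨ cong (_% m) (+-assoc (toℕ (f x)) _ _) ⟨
      (toℕ (f x) + toℕ (Vec.lookup z₀ (g x)) + Σz z gs x) % m     ≡⟨ [a%m+b]%m≡[a+b]%m _ _ ⟨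
      ((toℕ (f x) + toℕ (Vec.lookup z₀ (g x))) % m + Σz z gs x) % m
        ≡⟨ cong (λ u → (u + Σz z gs x) % m) (toℕ-mod _) ⟨
      (toℕ (shiftBy f z₀ g x) + Σz z gs x) % m                     ≡⟨ toℕ-mod _ ⟨
      toℕ (hashWith (shiftBy f z₀ g) z gs x)                       ∎)
    where open ≡-Reasoning

  hashWith-∷′ : {c : ℕ} (f : Fin n → Fin m) (z₀ : Vec (Fin m) ℓ) (z : Vec (Vec (Fin m) ℓ) c)
                (g : Fin n → Fin ℓ) (gs : Vec (Fin n → Fin ℓ) c) (x : Fin n) →
                hashWith f (z₀ ∷ᵥ z) (g ∷ᵥ gs) x ≡ addMod (Vec.lookup z₀ (g x)) (hashWith f z gs x)
  hashWith-∷′ f z₀ z g gs x = toℕ-injective (begin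
      toℕ (hashWith f (z₀ ∷ᵥ z) (g ∷ᵥ gs) x)                     ≡⟨ toℕ-mod _ ⟩
      (toℕ (f x) + (a + Σz z gs x)) % m                          ≡⟨ cong (_% m) (move a (toℕ (f x)) (Σz z gs x)) ⟩
      (a + (toℕ (f x) + Σz z gs x)) % m                          ≡⟨ [a+b%m]%m≡[a+b]%m _ _ ⟨
      (a + (toℕ (f x) + Σz z gs x) % m) % m                      ≡⟨ cong (λ u → (a + u) % m) (toℕ-mod _) ⟨
      (a + toℕ (hashWith f z gs x)) % m                          ≡⟨ toℕ-mod _ ⟨
      toℕ (addMod (Vec.lookup z₀ (g x)) (hashWith f z gs x))     ∎)
    where
    open ≡-Reasoning
    a = toℕ (Vec.lookup z₀ (g x))
    move : ∀ a b s → b + (a + s) ≡ a + (b + s)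
    move = solve-∀

  hashWith-[] : (f : Fin n → Fin m) (x : Fin n) → hashWith {ℓ = ℓ} f []ᵥ []ᵥ x ≡ f x
  hashWith-[] f x = toℕ-injective (trans (toℕ-mod _) (trans (cong (_% m) (+-identityʳ _)) (toℕ%m (f x))))

  sum-hashFamily : {c : ℕ} (F : List (Fin n → Fin m)) (gs : Vec (Fin n → Fin ℓ) c) (w : (Fin n → Fin m) → ℕ) →
                   ∑ (hashFamily F gs) w ≡ ∑ F (λ f → ∑ (vecsOver Vectors c) (λ z → w (hashWith f z gs)))
  sum-hashFamily {c} F gs w = trans (sum-concatMap _ F w) (sum-cong F (λ f → sum-map _ (vecsOver Vectors c) w))

  length-hashFamily : {c : ℕ} (F : List (Fin n → Fin m)) (gs : Vec (Fin n → Fin ℓ) c) →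
                      length (hashFamily F gs) ≡ length F * length (vecsOver Vectors c)
  length-hashFamily {c} F gs = trans (length-concatMap _ F)
    (trans (sum-cong F (λ f → LP.length-map _ (vecsOver Vectors c))) (sum-const F _))

  Extensional : ((Fin n → Fin m) → Bool) → Set
  Extensional p = ∀ h h′ → (∀ x → h x ≡ h′ x) → p h ≡ p h′

  -- Absorbing the first round z₀[g] into f turns c + 1 rounds over F into c rounds over shifted g F.
  count-hashFamily-∷ : {c : ℕ} (F : List (Fin n → Fin m)) (g : Fin n → Fin ℓ) (gs : Vec (Fin n → Fin ℓ) c)
    (p : (Fin n → Fin m) → Bool) → Extensional p →
    count p (hashFamily F (g ∷ᵥ gs)) ≡ count p (hashFamily (shifted g F) gs)
  count-hashFamily-∷ {c} F g gs p ext = begin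
      count p (hashFamily F (g ∷ᵥ gs))
        ≡⟨ trans (count≡sum p (hashFamily F (g ∷ᵥ gs))) (sum-hashFamily F (g ∷ᵥ gs) (ind ∘ p)) ⟩
      ∑ F (λ f → ∑ (vecsOver Vectors (suc c)) (λ z → ind (p (hashWith f z (g ∷ᵥ gs)))))
        ≡⟨ sum-cong F (λ f → trans (sum-vecsOver-suc Vectors c _)
             (sum-cong Vectors (λ z₀ → sum-cong (vecsOver Vectors c) (λ z → cong ind (ext _ _ (hashWith-∷ f z₀ z g gs)))))) ⟩
      ∑ F (λ f → ∑ Vectors (λ z₀ → W (shiftBy f z₀ g)))
        ≡⟨ trans (sum-concatMap _ F W) (sum-cong F (λ f → sum-map _ Vectors W)) ⟨
      ∑ (shifted g F) W
        ≡⟨ trans (count≡sum p (hashFamily (shifted g F) gs)) (sum-hashFamily (shifted g F) gs (ind ∘ p)) ⟨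
      count p (hashFamily (shifted g F) gs) ∎
    where
    open ≡-Reasoning
    W = λ f′ → ∑ (vecsOver Vectors c) (λ z → ind (p (hashWith f′ z gs)))

  count-hashFamily-[] : (F : List (Fin n → Fin m)) (p : (Fin n → Fin m) → Bool) → Extensional p →
                        count p (hashFamily F []ᵥ) ≡ count p F
  count-hashFamily-[] F p ext = trans (count≡sum p (hashFamily F []ᵥ)) (trans (sum-hashFamily F []ᵥ (ind ∘ p))
    (trans (sum-cong F (λ f → trans (+-identityʳ _) (cong ind (ext _ _ (hashWith-[] f))))) (sym (count≡sum p F))))

  length-hashFamily-∷ : {c : ℕ} (F : List (Fin n → Fin m)) (g : Fin n → Fin ℓ) (gs : Vec (Fin n → Fin ℓ) c) →
                        length (hashFamily F (g ∷ᵥ gs)) ≡ length (hashFamily (shifted g F) gs)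
  length-hashFamily-∷ F g gs = begin
    length (hashFamily F (g ∷ᵥ gs))                     ≡⟨ count-true (hashFamily F (g ∷ᵥ gs)) ⟨
    count (λ _ → true) (hashFamily F (g ∷ᵥ gs))         ≡⟨ count-hashFamily-∷ F g gs (λ _ → true) (λ _ _ _ → refl) ⟩
    count (λ _ → true) (hashFamily (shifted g F) gs)    ≡⟨ count-true (hashFamily (shifted g F) gs) ⟩
    length (hashFamily (shifted g F) gs)                ∎
    where open ≡-Reasoning

  length-hashFamily-[] : (F : List (Fin n → Fin m)) → length (hashFamily F []ᵥ) ≡ length F
  length-hashFamily-[] F = begin
    length (hashFamily F []ᵥ)               ≡⟨ count-true (hashFamily F []ᵥ) ⟨
    count (λ _ → true) (hashFamily F []ᵥ)   ≡⟨ count-hashFamily-[] F (λ _ → true) (λ _ _ _ → refl) ⟩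
    count (λ _ → true) F                    ≡⟨ count-true F ⟩
    length F                                ∎
    where open ≡-Reasoning

  shiftedAssignment : Vec (Fin m) ℓ → (Fin n → Fin ℓ) → Assignment n m → Assignment n m
  shiftedAssignment z₀ g ps = List.map (λ (p , v) → p , subMod v (Vec.lookup z₀ (g p))) ps

  fits-shiftBy : (z₀ : Vec (Fin m) ℓ) (g : Fin n → Fin ℓ) (ps : Assignment n m) (f : Fin n → Fin m) →
                 fits ps (shiftBy f z₀ g) ≡ fits (shiftedAssignment z₀ g ps) f
  fits-shiftBy z₀ g []             f = refl
  fits-shiftBy z₀ g ((p , v) ∷ ps) f = cong₂ _∧_ (eqb-addMod (f p) _ v) (fits-shiftBy z₀ g ps f)

  points-shiftedAssignment : (z₀ : Vec (Fin m) ℓ) (g : Fin n → Fin ℓ) (ps : Assignment n m) →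
                             points (shiftedAssignment z₀ g ps) ≡ points ps
  points-shiftedAssignment z₀ g []             = refl
  points-shiftedAssignment z₀ g ((p , v) ∷ ps) = cong (p ∷_) (points-shiftedAssignment z₀ g ps)

  -- For each fixed z₀ the shifted family is F with the targets moved.
  shifted-independent : (κ : ℕ) (g : Fin n → Fin ℓ) (F : List (Fin n → Fin m)) →
                        Independent n κ m F → Independent n κ m (shifted g F)
  shifted-independent κ g F independent ps u ps≤κ = begin
      count (fits ps) (shifted g F) * K
        ≡⟨ cong (_* K) (trans (count≡sum (fits ps) (shifted g F)) (trans (sum-concatMap (λ f → List.map (λ z₀ → shiftBy f z₀ g) Vectors) F _)
             (sum-cong F (λ f → sum-map _ Vectors (ind ∘ fits ps))))) ⟩
      ∑ F (λ f → ∑ Vectors (λ z₀ → ind (fits ps (shiftBy f z₀ g)))) * K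
        ≡⟨ cong (_* K) (sum-swap F Vectors _) ⟩
      ∑ Vectors (λ z₀ → ∑ F (λ f → ind (fits ps (shiftBy f z₀ g)))) * K
        ≡⟨ sum-*ʳ K Vectors _ ⟨
      ∑ Vectors (λ z₀ → ∑ F (λ f → ind (fits ps (shiftBy f z₀ g))) * K)
        ≡⟨ sum-cong Vectors (λ z₀ → trans (cong₂ _*_
             (trans (sum-cong F (λ f → cong ind (fits-shiftBy z₀ g ps f))) (sym (count≡sum _ F)))
             (cong (m ^_) (sym (LP.length-map _ ps))))
             (independent (shiftedAssignment z₀ g ps)
               (subst Unique (sym (points-shiftedAssignment z₀ g ps)) u)
               (≤-trans (≤-reflexive (LP.length-map _ ps)) ps≤κ))) ⟩
      ∑ Vectors (λ _ → length F)
        ≡⟨ sum-const Vectors (length F) ⟩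
      length Vectors * length F
        ≡⟨ trans (length-concatMap _ F) (trans (sum-cong F (λ f → LP.length-map _ Vectors))
             (trans (sum-const F _) (*-comm (length F) _))) ⟨
      length (shifted g F) ∎
    where
    open ≡-Reasoning
    K = m ^ length ps

  hashFamily-independent : {c : ℕ} (κ : ℕ) (gs : Vec (Fin n → Fin ℓ) c) (F : List (Fin n → Fin m)) →
                           Independent n κ m F → Independent n κ m (hashFamily F gs)
  hashFamily-independent κ []ᵥ F independent ps u ps≤κ = begin
      count (fits ps) (hashFamily F []ᵥ) * m ^ length ps ≡⟨ cong (_* m ^ length ps) (count-hashFamily-[] F (fits ps) (λ _ _ → fits-cong ps)) ⟩
      count (fits ps) F * m ^ length ps                  ≡⟨ independent ps u ps≤κ ⟩
      length F                                           ≡⟨ length-hashFamily-[] F ⟨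
      length (hashFamily F []ᵥ)                          ∎
    where open ≡-Reasoning
  hashFamily-independent κ (g ∷ᵥ gs) F independent ps u ps≤κ = begin
      count (fits ps) (hashFamily F (g ∷ᵥ gs)) * m ^ length ps
        ≡⟨ cong (_* m ^ length ps) (count-hashFamily-∷ F g gs (fits ps) (λ _ _ → fits-cong ps)) ⟩
      count (fits ps) (hashFamily (shifted g F) gs) * m ^ length ps
        ≡⟨ hashFamily-independent κ gs (shifted g F) (shifted-independent κ g F independent) ps u ps≤κ ⟩
      length (hashFamily (shifted g F) gs)
        ≡⟨ length-hashFamily-∷ F g gs ⟨
      length (hashFamily F (g ∷ᵥ gs)) ∎
    where open ≡-Reasoning

agreesOn : {n r : ℕ} → (Fin n → Fin r) → List (Fin n) → (Fin n → Fin r) → Bool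
agreesOn b xs h = all (λ x → eqb (h x) (b x)) xs

graphOn : {n r : ℕ} → (Fin n → Fin r) → List (Fin n) → Assignment n r
graphOn b xs = List.map (λ x → (x , b x)) xs

agreesOn≡fits : {n r : ℕ} (b : Fin n → Fin r) (xs : List (Fin n)) (h : Fin n → Fin r) →
                agreesOn b xs h ≡ fits (graphOn b xs) h
agreesOn≡fits b []       h = refl
agreesOn≡fits b (x ∷ xs) h = cong (eqb (h x) (b x) ∧_) (agreesOn≡fits b xs h)

points-graphOn : {n r : ℕ} (b : Fin n → Fin r) (xs : List (Fin n)) → points (graphOn b xs) ≡ xs
points-graphOn b []       = refl
points-graphOn b (x ∷ xs) = cong (x ∷_) (points-graphOn b xs)

-- Unfolded form of d_T ≤ k: either |T| ≤ 2k, or some gⱼ satisfies |T| ≤ k + |gⱼ(T)|.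
LowDeficiency : {n ℓ c : ℕ} → ℕ → Subset n → Vec (Fin n → Fin ℓ) c → Set
LowDeficiency k T gs = (∣ T ∣ ≤ 2 * k) ⊎ VAny.Any (λ g → ∣ T ∣ ≤ k + ∣ image g T ∣) gs

module _ {n ℓ m : ℕ} .{{_ : NonZero m}} (k : ℕ) (T : Subset n) (b : Fin n → Fin m) where
  open ModularArithmetic m
  open HashFamily {n} {ℓ} {m}

  private
    agreesOn-ext : Extensional (agreesOn b (elements T))
    agreesOn-ext h h′ e = all-cong (elements T) (λ x → cong (λ u → eqb u (b x)) (e x))

  hashFamily-uniform-small : {c : ℕ} (gs : Vec (Fin n → Fin ℓ) c) (F : List (Fin n → Fin m)) →
    Independent n (2 * k) m F → ∣ T ∣ ≤ 2 * k →
    count (agreesOn b (elements T)) (hashFamily F gs) * m ^ ∣ T ∣ ≡ length (hashFamily F gs)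
  hashFamily-uniform-small gs F independent T≤2k =
    trans (cong₂ _*_ (count-cong (hashFamily F gs) (agreesOn≡fits b (elements T))) (cong (m ^_) (sym length-graph)))
          (hashFamily-independent (2 * k) gs F independent (graphOn b (elements T))
            (subst Unique (sym (points-graphOn b (elements T))) (elements-unique T))
            (≤-trans (≤-reflexive length-graph) T≤2k))
    where
    length-graph : length (graphOn b (elements T)) ≡ ∣ T ∣
    length-graph = trans (LP.length-map _ (elements T)) (length-elements T)

  -- Earlier rounds are absorbed into f (count-hashFamily-∷); at the good round gⱼ the remaining
  -- rounds are absorbed into the offset, which is uniform by offset-uniform.
  hashFamily-uniform-any : {c : ℕ} (gs : Vec (Fin n → Fin ℓ) c) (F : List (Fin n → Fin m)) →
    Independent n (2 * k) m F → VAny.Any (λ g → ∣ T ∣ ≤ k + ∣ image g T ∣) gs →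
    count (agreesOn b (elements T)) (hashFamily F gs) * m ^ ∣ T ∣ ≡ length (hashFamily F gs)
  hashFamily-uniform-any (g ∷ᵥ gs) F independent (thereᵥ good) = begin
      count A (hashFamily F (g ∷ᵥ gs)) * m ^ ∣ T ∣
        ≡⟨ cong (_* m ^ ∣ T ∣) (count-hashFamily-∷ F g gs A agreesOn-ext) ⟩
      count A (hashFamily (shifted g F) gs) * m ^ ∣ T ∣
        ≡⟨ hashFamily-uniform-any gs (shifted g F) (shifted-independent (2 * k) g F independent) good ⟩
      length (hashFamily (shifted g F) gs)
        ≡⟨ length-hashFamily-∷ F g gs ⟨
      length (hashFamily F (g ∷ᵥ gs)) ∎
    where
    open ≡-Reasoning
    A = agreesOn b (elements T)
  hashFamily-uniform-any {suc c} (g ∷ᵥ gs) F independent (hereᵥ T≤k+gT) = begin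
      count A (hashFamily F (g ∷ᵥ gs)) * K
        ≡⟨ cong (_* K) (trans (count≡sum A (hashFamily F (g ∷ᵥ gs))) (sum-hashFamily F (g ∷ᵥ gs) (ind ∘ A))) ⟩
      ∑ F (λ f → ∑ (vecsOver Vectors (suc c)) (λ z → ind (A (hashWith f z (g ∷ᵥ gs))))) * K
        ≡⟨ cong (_* K) (sum-cong F (λ f → trans (sum-vecsOver-suc Vectors c _)
             (trans (sum-cong Vectors (λ z₀ → sum-cong (vecsOver Vectors c)
                       (λ z → cong ind (agreesOn-ext _ _ (hashWith-∷′ f z₀ z g gs)))))
                    (sum-swap Vectors (vecsOver Vectors c) _)))) ⟩
      ∑ F (λ f → ∑ (vecsOver Vectors c) (λ z → W (hashWith f z gs))) * K
        ≡⟨ cong (_* K) (sum-hashFamily F gs W) ⟨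
      ∑ (hashFamily F gs) W * K
        ≡⟨ cong (_* K) (sum-cong (hashFamily F gs) (λ h → count≡sum _ Vectors)) ⟨
      ∑ (hashFamily F gs) (λ h → count (λ z₀ → offsetHits z₀ h) Vectors) * K
        ≡⟨ offset-uniform k (hashFamily F gs) (hashFamily-independent (2 * k) gs F independent) T g T≤k+gT b ⟩
      length (hashFamily F gs) * m ^ ℓ
        ≡⟨ cong (_* m ^ ℓ) (length-hashFamily F gs) ⟩
      length F * length (vecsOver Vectors c) * m ^ ℓ
        ≡⟨ rearrange (length F) (length (vecsOver Vectors c)) (m ^ ℓ) ⟩
      length F * (m ^ ℓ * length (vecsOver Vectors c))
        ≡⟨ cong (λ v → length F * (v * length (vecsOver Vectors c))) length-Vectors ⟨
      length F * (length Vectors * length (vecsOver Vectors c))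
        ≡⟨ cong (length F *_) (cong (length Vectors *_) (length-vecsOver Vectors c)) ⟩
      length F * length Vectors ^ suc c
        ≡⟨ cong (length F *_) (length-vecsOver Vectors (suc c)) ⟨
      length F * length (vecsOver Vectors (suc c))
        ≡⟨ length-hashFamily F (g ∷ᵥ gs) ⟨
      length (hashFamily F (g ∷ᵥ gs)) ∎
    where
    open ≡-Reasoning
    A = agreesOn b (elements T)
    K = m ^ ∣ T ∣
    offsetHits = λ (z₀ : Vec (Fin m) ℓ) (h : Fin n → Fin m) →
      all (λ x → eqb (addMod (Vec.lookup z₀ (g x)) (h x)) (b x)) (elements T)
    W = λ h → ∑ Vectors (λ z₀ → ind (offsetHits z₀ h))
    length-Vectors : length Vectors ≡ m ^ ℓ
    length-Vectors = trans (length-vecsOver (allFin m) ℓ) (cong (_^ ℓ) (length-allFin m))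
    rearrange : ∀ a z v → a * z * v ≡ a * (v * z)
    rearrange = solve-∀

  hashFamily-uniform : {c : ℕ} (gs : Vec (Fin n → Fin ℓ) c) (F : List (Fin n → Fin m)) →
    Independent n (2 * k) m F → LowDeficiency k T gs →
    count (agreesOn b (elements T)) (hashFamily F gs) * m ^ ∣ T ∣ ≡ length (hashFamily F gs)
  hashFamily-uniform gs F independent (inj₁ T≤2k) = hashFamily-uniform-small gs F independent T≤2k
  hashFamily-uniform gs F independent (inj₂ good) = hashFamily-uniform-any gs F independent good

-- Part (a): a single g rarely has k collisions on T

∈-vecsOver : {A : Set} (xs : List A) (k : ℕ) (v : Vec A k) → (∀ a → a ∈ Vec.toList v → a ∈ xs) → v ∈ vecsOver xs k
∈-vecsOver xs zero    []ᵥ      v⊆xs = here refl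
∈-vecsOver xs (suc k) (a ∷ᵥ v) v⊆xs =
  ∈-concatMap⁺ (λ x → List.map (x ∷ᵥ_) (vecsOver xs k))
    (LAny.map (λ { refl → ∈-map⁺ (a ∷ᵥ_) (∈-vecsOver xs k v (λ b b∈v → v⊆xs b (there b∈v))) }) (v⊆xs a (here refl)))

takeVec : {A : Set} (k : ℕ) (xs : List A) → k ≤ length xs → Vec A k
takeVec zero    xs       k≤ = []ᵥ
takeVec (suc k) (x ∷ xs) (s≤s k≤) = x ∷ᵥ takeVec k xs k≤

takeVec⊆ : {A : Set} (k : ℕ) (xs : List A) (k≤ : k ≤ length xs) (a : A) → a ∈ Vec.toList (takeVec k xs k≤) → a ∈ xs
takeVec⊆ (suc k) (x ∷ xs) (s≤s k≤) a (here a≡x) = here a≡x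
takeVec⊆ (suc k) (x ∷ xs) (s≤s k≤) a (there a∈) = there (takeVec⊆ k xs k≤ a a∈)

all-takeVec : {A : Set} (P : A → Bool) (k : ℕ) (xs : List A) (k≤ : k ≤ length xs) →
              all P xs ≡ true → all P (Vec.toList (takeVec k xs k≤)) ≡ true
all-takeVec P zero    xs       k≤       e = refl
all-takeVec P (suc k) (x ∷ xs) (s≤s k≤) e with P x
... | true = all-takeVec P k xs k≤ e

FreshLinks-takeVec : {n : ℕ} (S : List (Fin n)) (k : ℕ) (ls : List (Fin n × Fin n)) (k≤ : k ≤ length ls) →
                     FreshLinks S ls → FreshLinks S (Vec.toList (takeVec k ls k≤))
FreshLinks-takeVec S zero    ls             k≤       fresh = tt
FreshLinks-takeVec S (suc k) ((x , y) ∷ ls) (s≤s k≤) (y∉S , x≢y , fresh) =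
  y∉S , x≢y , FreshLinks-takeVec (x ∷ y ∷ S) k ls k≤ fresh

freshLinks? : {n : ℕ} (S : List (Fin n)) (ls : List (Fin n × Fin n)) → Dec (FreshLinks S ls)
freshLinks? S []             = yes tt
freshLinks? {n} S ((x , y) ∷ ls) = ¬? (y ∈? S) ×-dec (¬? (x ≟ y) ×-dec freshLinks? (x ∷ y ∷ S) ls)
  where open DecMembership (_≟_ {n}) using (_∈?_)

pairs : {A : Set} → List A → List (A × A)
pairs xs = concatMap (λ x → List.map (λ y → (x , y)) xs) xs

length-pairs : {A : Set} (xs : List A) → length (pairs xs) ≡ length xs * length xs
length-pairs xs = trans (length-concatMap _ xs) (trans (sum-cong xs (λ x → LP.length-map _ xs)) (sum-const xs _))

∈-pairs : {A : Set} (xs : List A) {x y : A} → x ∈ xs → y ∈ xs → (x , y) ∈ pairs xs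
∈-pairs xs x∈ y∈ = ∈-concatMap⁺ (λ x → List.map (λ y → (x , y)) xs) (LAny.map (λ { refl → ∈-map⁺ (_ ,_) y∈ }) x∈)

sameValue : {n ℓ : ℕ} → Fin n → Fin n → Fin ℓ → Fin ℓ → Bool
sameValue _ _ u v = eqb v u

module _ {n ℓ : ℕ} .{{_ : NonZero ℓ}} (k : ℕ) (T : Subset n) where

  collapses : (Fin n → Fin ℓ) → Bool
  collapses g = ⌊ k + ∣ image g T ∣ ≤? ∣ T ∣ ⌋

  collapses-sound : (g : Fin n → Fin ℓ) → collapses g ≡ true → k + ∣ image g T ∣ ≤ ∣ T ∣
  collapses-sound g e with k + ∣ image g T ∣ ≤? ∣ T ∣
  collapses-sound g e  | yes k+gT≤T = k+gT≤T
  collapses-sound g () | no _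

  collapses-complete : (g : Fin n → Fin ℓ) → k + ∣ image g T ∣ ≤ ∣ T ∣ → collapses g ≡ true
  collapses-complete g k+gT≤T with k + ∣ image g T ∣ ≤? ∣ T ∣
  ... | yes _     = refl
  ... | no k+gT≰T = ⊥-elim (k+gT≰T k+gT≤T)

  constantAlong : Vec (Fin n × Fin n) k → (Fin n → Fin ℓ) → Bool
  constantAlong ls g = does (freshLinks? [] (Vec.toList ls)) ∧ linked sameValue (Vec.toList ls) g

  -- The first k links produced by the representatives witness that g collapses T.
  collapses⇒constantAlong : ∀ g → collapses g ≡ true →
                             ∃ λ ls → ls ∈ vecsOver (pairs (elements T)) k × constantAlong ls g ≡ true
  collapses⇒constantAlong g e =
      ls
    , ∈-vecsOver (pairs (elements T)) k ls ls⊆pairs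
    , cong₂ _∧_ (dec-true (freshLinks? [] (Vec.toList ls))
                  (FreshLinks-takeVec [] k N k≤N
                    (links-fresh [] [] (elements T) (elements-unique T) (λ _ _ ()) (λ _ _ ()))))
                (all-takeVec _ k N k≤N (all-intro _ N λ { (r , y) l∈N →
                  subst (λ w → eqb w (g r) ≡ true) (proj₂ (proj₂ (links-sound [] (elements T) r y l∈N))) (eqb-refl (g r)) }))
    where
    open Representatives g
    N = links [] (elements T)
    k≤N = ≤length-links g T k (collapses-sound g e)
    ls = takeVec k N k≤N
    ls⊆pairs : ∀ l → l ∈ Vec.toList ls → l ∈ pairs (elements T)
    ls⊆pairs (r , y) l∈ with links-sound [] (elements T) r y (takeVec⊆ k N k≤N (r , y) l∈)
    ... | inj₂ r∈T , y∈T , _ = ∈-pairs (elements T) r∈T y∈T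

  count-constantAlong : (G : List (Fin n → Fin ℓ)) → Independent n (2 * k) ℓ G → (ls : Vec (Fin n × Fin n) k) →
                        count (constantAlong ls) G * ℓ ^ k ≤ length G
  count-constantAlong G independent ls with freshLinks? [] (Vec.toList ls)
  ... | no _      = ≤-trans (≤-reflexive (cong (_* ℓ ^ k) (count-const∧ false (linked sameValue (Vec.toList ls)) G))) z≤n
  ... | yes fresh = ≤-reflexive (trans (cong (λ e → count (linked sameValue (Vec.toList ls)) G * ℓ ^ e) (sym length-ls))
      (count-linked G independent sameValue (λ _ _ u → exactlyOne-eqbʳ u) (Vec.toList ls) [] [] [] (λ ()) fresh
        (≤-reflexive (cong (2 *_) length-ls))))
    where
    length-ls : length (Vec.toList ls) ≡ k
    length-ls = VP.length-toList ls

  -- Union bound over the |T|^{2k} sequences of k links.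
  count-collapses : (G : List (Fin n → Fin ℓ)) → Independent n (2 * k) ℓ G →
                    count collapses G * ℓ ^ k ≤ ∣ T ∣ ^ (2 * k) * length G
  count-collapses G independent = begin
      count collapses G * ℓ ^ k
        ≤⟨ *-monoˡ-≤ (ℓ ^ k) (union-bound collapses constantAlong Seqs G collapses⇒constantAlong) ⟩
      ∑ Seqs (λ ls → count (constantAlong ls) G) * ℓ ^ k
        ≡⟨ sum-*ʳ (ℓ ^ k) Seqs _ ⟨
      ∑ Seqs (λ ls → count (constantAlong ls) G * ℓ ^ k)
        ≤⟨ sum-mono Seqs (count-constantAlong G independent) ⟩
      ∑ Seqs (λ _ → length G)
        ≡⟨ sum-const Seqs (length G) ⟩
      length Seqs * length G
        ≡⟨ cong (_* length G) length-Seqs ⟩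
      ∣ T ∣ ^ (2 * k) * length G ∎
    where
    open ≤-Reasoning
    Seqs = vecsOver (pairs (elements T)) k
    length-Seqs : length Seqs ≡ ∣ T ∣ ^ (2 * k)
    length-Seqs = begin-equality
      length Seqs                              ≡⟨ length-vecsOver (pairs (elements T)) k ⟩
      length (pairs (elements T)) ^ k          ≡⟨ cong (_^ k) (length-pairs (elements T)) ⟩
      (length (elements T) * length (elements T)) ^ k
        ≡⟨ cong (λ t → (t * t) ^ k) (length-elements T) ⟩
      (∣ T ∣ * ∣ T ∣) ^ k                        ≡⟨ cong (λ t → (∣ T ∣ * t) ^ k) (*-identityʳ ∣ T ∣) ⟨
      (∣ T ∣ ^ 2) ^ k                          ≡⟨ ^-*-assoc ∣ T ∣ 2 k ⟩
      ∣ T ∣ ^ (2 * k)                          ∎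

module _ (t M k : ℕ) where

  private
    [t-M]+M≡t : (ℤ.+ t ℤ.- ℤ.+ M) ℤ.+ ℤ.+ M ≡ ℤ.+ t
    [t-M]+M≡t = cancel (ℤ.+ t) (ℤ.+ M)
      where
      cancel : ∀ a b → (a ℤ.- b) ℤ.+ b ≡ a
      cancel = ℤsolve-∀

  t-M≤k⇒t≤k+M : (ℤ.+ t ℤ.- ℤ.+ M) ℤ.≤ ℤ.+ k → t ≤ k + M
  t-M≤k⇒t≤k+M d≤k = ℤP.drop‿+≤+ (subst (ℤ._≤ ℤ.+ (k + M)) [t-M]+M≡t (ℤP.+-monoˡ-≤ (ℤ.+ M) d≤k))

  k<t-M⇒k+M<t : ℤ.+ k ℤ.< (ℤ.+ t ℤ.- ℤ.+ M) → k + M < t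
  k<t-M⇒k+M<t k<d = ℤP.drop‿+<+ (subst (ℤ.+ (k + M) ℤ.<_) [t-M]+M≡t (ℤP.+-monoˡ-< (ℤ.+ M) k<d))

  t-M≡k⇒t≡k+M : (ℤ.+ t ℤ.- ℤ.+ M) ≡ ℤ.+ k → t ≡ k + M
  t-M≡k⇒t≡k+M d≡k = ℤP.+-injective (trans (sym [t-M]+M≡t) (cong (ℤ._+ ℤ.+ M) d≡k))

-- goodOn, critOn and badOn are good, crit and bad of Defs, seen as functions of g₁ … g_c.
module _ {n ℓ : ℕ} (k : ℕ) (T : Subset n) where

  maxImage : {c : ℕ} → Vec (Fin n → Fin ℓ) c → ℕ
  maxImage gs = List.foldr _⊔_ k (List.map (λ g → ∣ image g T ∣) (Vec.toList gs))

  deficiencyOn : {c : ℕ} → Vec (Fin n → Fin ℓ) c → ℤ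
  deficiencyOn gs = ℤ.+ ∣ T ∣ ℤ.- ℤ.+ maxImage gs

  goodOn critOn badOn : {c : ℕ} → Vec (Fin n → Fin ℓ) c → Bool
  goodOn gs = ⌊ deficiencyOn gs ℤ.≤? ℤ.+ k ⌋
  critOn gs = ⌊ deficiencyOn gs ℤ.≟ ℤ.+ k ⌋
  badOn  gs = ⌊ ℤ.+ k ℤ.<? deficiencyOn gs ⌋

  goodOn-sound : {c : ℕ} (gs : Vec (Fin n → Fin ℓ) c) → goodOn gs ≡ true → ∣ T ∣ ≤ k + maxImage gs
  goodOn-sound gs e with deficiencyOn gs ℤ.≤? ℤ.+ k
  ... | yes d≤k = t-M≤k⇒t≤k+M _ _ k d≤k

  critOn⇒goodOn : {c : ℕ} (gs : Vec (Fin n → Fin ℓ) c) → critOn gs ≡ true → goodOn gs ≡ true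
  critOn⇒goodOn gs e with deficiencyOn gs ℤ.≟ ℤ.+ k
  ... | yes d≡k with deficiencyOn gs ℤ.≤? ℤ.+ k
  ...   | yes _ = refl
  ...   | no d≰k = ⊥-elim (d≰k (ℤP.≤-reflexive d≡k))

  badOn∨critOn-sound : {c : ℕ} (gs : Vec (Fin n → Fin ℓ) c) → badOn gs ∨ critOn gs ≡ true → k + maxImage gs ≤ ∣ T ∣
  badOn∨critOn-sound gs e with ℤ.+ k ℤ.<? deficiencyOn gs
  ... | yes k<d = <⇒≤ (k<t-M⇒k+M<t _ _ k k<d)
  ... | no _ with deficiencyOn gs ℤ.≟ ℤ.+ k
  ...   | yes d≡k = ≤-reflexive (sym (t-M≡k⇒t≡k+M _ _ k d≡k))

  ≤maxImage : {c : ℕ} (gs : Vec (Fin n → Fin ℓ) c) (g : Fin n → Fin ℓ) → g ∈ Vec.toList gs →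
              ∣ image g T ∣ ≤ maxImage gs
  ≤maxImage gs g g∈gs = ≤-foldr (∈-map⁺ (λ g → ∣ image g T ∣) g∈gs)
    where
    ≤-foldr : ∀ {x xs} → x ∈ xs → x ≤ List.foldr _⊔_ k xs
    ≤-foldr {xs = y ∷ xs} (here refl) = m≤m⊔n y _
    ≤-foldr {xs = y ∷ xs} (there x∈)  = ≤-trans (≤-foldr x∈) (m≤n⊔m y _)

  maxImage-attained : {c : ℕ} (gs : Vec (Fin n → Fin ℓ) c) →
                      (maxImage gs ≡ k) ⊎ VAny.Any (λ g → maxImage gs ≡ ∣ image g T ∣) gs
  maxImage-attained []ᵥ = inj₁ refl
  maxImage-attained (g ∷ᵥ gs) with ⊔-sel ∣ image g T ∣ (maxImage gs)
  ... | inj₁ max≡g = inj₂ (hereᵥ max≡g)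
  ... | inj₂ max≡rest with maxImage-attained gs
  ...   | inj₁ rest≡k = inj₁ (trans max≡rest rest≡k)
  ...   | inj₂ any    = inj₂ (thereᵥ (VAny.map (trans max≡rest) any))

  goodOn⇒LowDeficiency : {c : ℕ} (gs : Vec (Fin n → Fin ℓ) c) → goodOn gs ≡ true → LowDeficiency k T gs
  goodOn⇒LowDeficiency gs e with maxImage-attained gs
  ... | inj₁ max≡k = inj₁ (≤-trans (goodOn-sound gs e)
                            (≤-reflexive (cong (k +_) (trans max≡k (sym (+-identityʳ k))))))
  ... | inj₂ any   = inj₂ (VAny.map (λ max≡gT → ≤-trans (goodOn-sound gs e) (≤-reflexive (cong (k +_) max≡gT))) any)

^-distribʳ-* : ∀ a b c → (a * b) ^ c ≡ a ^ c * b ^ c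
^-distribʳ-* a b zero    = refl
^-distribʳ-* a b (suc c) = trans (cong (a * b *_) (^-distribʳ-* a b c)) (interchange a b (a ^ c) (b ^ c))
  where
  interchange : ∀ a b x y → a * b * (x * y) ≡ a * x * (b * y)
  interchange = solve-∀

count-all-vecsOver : {A : Set} (p : A → Bool) (xs : List A) (c : ℕ) →
                     count (λ v → all p (Vec.toList v)) (vecsOver xs c) ≡ count p xs ^ c
count-all-vecsOver p xs zero    = refl
count-all-vecsOver p xs (suc c) = begin
    count (λ v → all p (Vec.toList v)) (vecsOver xs (suc c))
      ≡⟨ trans (count≡sum _ (vecsOver xs (suc c))) (sum-vecsOver-suc xs c _) ⟩
    ∑ xs (λ x → ∑ (vecsOver xs c) (λ v → ind (p x ∧ all p (Vec.toList v))))
      ≡⟨ sum-cong xs (λ x → trans (sym (count≡sum _ (vecsOver xs c))) (count-const∧ (p x) _ (vecsOver xs c))) ⟩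
    ∑ xs (λ x → ind (p x) * count (λ v → all p (Vec.toList v)) (vecsOver xs c))
      ≡⟨ sum-*ʳ _ xs (ind ∘ p) ⟩
    ∑ xs (ind ∘ p) * count (λ v → all p (Vec.toList v)) (vecsOver xs c)
      ≡⟨ cong₂ _*_ (sym (count≡sum p xs)) (count-all-vecsOver p xs c) ⟩
    count p xs * count p xs ^ c ∎
  where open ≡-Reasoning

module Space {n ℓ m : ℕ} (c : ℕ) (F : List (Fin n → Fin m)) (G : List (Fin n → Fin ℓ)) where

  Zs : List (Vec (Vec (Fin m) ℓ) c)
  Zs = vecsOver (vecsOver (allFin m) ℓ) c

  Gs : List (Vec (Fin n → Fin ℓ) c)
  Gs = vecsOver G c

  sum-space : (w : Sample n ℓ m c → ℕ) → ∑ (space c F G) w ≡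
    ∑ Gs (λ gs → ∑ F (λ f₁ → ∑ F (λ f₂ → ∑ Zs (λ z₁ → ∑ Zs (λ z₂ → w (sample f₁ f₂ gs z₁ z₂))))))
  sum-space w = begin
      ∑ (space c F G) w
        ≡⟨ trans (sum-concatMap _ F w) (sum-cong F (λ f₁ → trans (sum-concatMap _ F w) (sum-cong F (λ f₂ →
             trans (sum-concatMap _ Gs w) (sum-cong Gs (λ gs →
               trans (sum-concatMap _ Zs w) (sum-cong Zs (λ z₁ → sum-map _ Zs w)))))))) ⟩
      ∑ F (λ f₁ → ∑ F (λ f₂ → ∑ Gs (λ gs → W gs f₁ f₂)))
        ≡⟨ sum-cong F (λ f₁ → sum-swap F Gs (λ f₂ gs → W gs f₁ f₂)) ⟩
      ∑ F (λ f₁ → ∑ Gs (λ gs → ∑ F (λ f₂ → W gs f₁ f₂)))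
        ≡⟨ sum-swap F Gs _ ⟩
      ∑ Gs (λ gs → ∑ F (λ f₁ → ∑ F (λ f₂ → W gs f₁ f₂))) ∎
    where
    open ≡-Reasoning
    W = λ gs f₁ f₂ → ∑ Zs (λ z₁ → ∑ Zs (λ z₂ → w (sample f₁ f₂ gs z₁ z₂)))

  sum-space-gs : (w : Vec (Fin n → Fin ℓ) c → ℕ) →
    ∑ (space c F G) (λ s → w (gs s)) ≡ length F * length F * length Zs * length Zs * ∑ Gs w
  sum-space-gs w = begin
      ∑ (space c F G) (λ s → w (gs s))
        ≡⟨ sum-space (λ s → w (gs s)) ⟩
      ∑ Gs (λ gs → ∑ F (λ _ → ∑ F (λ _ → ∑ Zs (λ _ → ∑ Zs (λ _ → w gs)))))
        ≡⟨ sum-cong Gs (λ gs → trans (sum-const F _) (cong (length F *_) (trans (sum-const F _)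
             (cong (length F *_) (trans (sum-const Zs _) (cong (length Zs *_) (sum-const Zs (w gs)))))))) ⟩
      ∑ Gs (λ gs → length F * (length F * (length Zs * (length Zs * w gs))))
        ≡⟨ sum-cong Gs (λ gs → reassoc (length F) (length F) (length Zs) (length Zs) (w gs)) ⟩
      ∑ Gs (λ gs → length F * length F * length Zs * length Zs * w gs)
        ≡⟨ sum-*ˡ (length F * length F * length Zs * length Zs) Gs w ⟩
      length F * length F * length Zs * length Zs * ∑ Gs w ∎
    where
    open ≡-Reasoning
    reassoc : ∀ a b c d e → a * (b * (c * (d * e))) ≡ a * b * c * d * e
    reassoc = solve-∀

module _ {n ℓ m : ℕ} .{{_ : NonZero m}} (k c : ℕ) (F : List (Fin n → Fin m))
         (independent : Independent n (2 * k) m F) (G : List (Fin n → Fin ℓ)) (T : Subset n) where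
  open Space c F G
  open HashFamily {n} {ℓ} {m}

  matches-split : (a : Fin n → Fin m × Fin m) (s : Sample n ℓ m c) →
    matches T a s ≡ agreesOn (proj₁ ∘ a) (elements T) (h₁ s) ∧ agreesOn (proj₂ ∘ a) (elements T) (h₂ s)
  matches-split a s = trans (all-elements T _) (all-∧ _ _ (elements T))

  -- For fixed g₁ … g_c the samples are pairs of independent draws from hashFamily F gs.
  uniform-for : (gs : Vec (Fin n → Fin ℓ) c) → LowDeficiency k T gs → (a : Fin n → Fin m × Fin m) →
    ∑ F (λ f₁ → ∑ F (λ f₂ → ∑ Zs (λ z₁ → ∑ Zs (λ z₂ → ind (matches T a (sample f₁ f₂ gs z₁ z₂))))))
      * (m * m) ^ ∣ T ∣
      ≡ ∑ F (λ _ → ∑ F (λ _ → ∑ Zs (λ _ → ∑ Zs (λ _ → 1))))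
  uniform-for gs low a = begin
      ∑ F (λ f₁ → ∑ F (λ f₂ → ∑ Zs (λ z₁ → ∑ Zs (λ z₂ → ind (matches T a (sample f₁ f₂ gs z₁ z₂)))))) * K
        ≡⟨ cong (_* K) (sum-cong F (λ f₁ → sum-cong F (λ f₂ → sum-cong Zs (λ z₁ → sum-cong Zs (λ z₂ →
             trans (cong ind (matches-split a (sample f₁ f₂ gs z₁ z₂))) (ind-∧ (A₁ (hashWith f₁ z₁ gs)) (A₂ (hashWith f₂ z₂ gs)))))))) ⟩
      ∑ F (λ f₁ → ∑ F (λ f₂ → ∑ Zs (λ z₁ → ∑ Zs (λ z₂ → x₁ f₁ z₁ * x₂ f₂ z₂)))) * K
        ≡⟨ cong (_* K) (sum-separate F F Zs Zs x₁ x₂) ⟩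
      ∑ F (λ f → ∑ Zs (x₁ f)) * ∑ F (λ f → ∑ Zs (x₂ f)) * K
        ≡⟨ cong₂ (λ u v → u * v * K) (count-agreesOn b₁) (count-agreesOn b₂) ⟩
      count A₁ H * count A₂ H * K
        ≡⟨ cong (count A₁ H * count A₂ H *_) (^-distribʳ-* m m ∣ T ∣) ⟩
      count A₁ H * count A₂ H * (m ^ ∣ T ∣ * m ^ ∣ T ∣)
        ≡⟨ interchange (count A₁ H) (count A₂ H) (m ^ ∣ T ∣) ⟩
      (count A₁ H * m ^ ∣ T ∣) * (count A₂ H * m ^ ∣ T ∣)
        ≡⟨ cong₂ _*_ (hashFamily-uniform k T b₁ gs F independent low) (hashFamily-uniform k T b₂ gs F independent low) ⟩
      length H * length H
        ≡⟨ cong₂ _*_ size size ⟨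
      ∑ F (λ _ → ∑ Zs (λ _ → 1)) * ∑ F (λ _ → ∑ Zs (λ _ → 1))
        ≡⟨ sum-separate F F Zs Zs (λ _ _ → 1) (λ _ _ → 1) ⟨
      ∑ F (λ _ → ∑ F (λ _ → ∑ Zs (λ _ → ∑ Zs (λ _ → 1)))) ∎
    where
    open ≡-Reasoning
    K = (m * m) ^ ∣ T ∣
    H = hashFamily F gs
    b₁ = proj₁ ∘ a
    b₂ = proj₂ ∘ a
    A₁ = agreesOn b₁ (elements T)
    A₂ = agreesOn b₂ (elements T)
    x₁ = λ f z → ind (A₁ (hashWith f z gs))
    x₂ = λ f z → ind (A₂ (hashWith f z gs))
    count-agreesOn : (b : Fin n → Fin m) →
           ∑ F (λ f → ∑ Zs (λ z → ind (agreesOn b (elements T) (hashWith f z gs)))) ≡ count (agreesOn b (elements T)) H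
    count-agreesOn b = sym (trans (count≡sum _ H) (sum-hashFamily F gs _))
    size : ∑ F (λ _ → ∑ Zs (λ _ → 1)) ≡ length H
    size = sym (trans (length≡sum H) (sum-hashFamily F gs _))
    interchange : ∀ p q r → p * q * (r * r) ≡ (p * r) * (q * r)
    interchange = solve-∀

  uniform-given : (P : Vec (Fin n → Fin ℓ) c → Bool) → (∀ gs → P gs ≡ true → LowDeficiency k T gs) →
    (a : Fin n → Fin m × Fin m) →
    count (λ s → P (gs s) ∧ matches T a s) (space c F G) * (m * m) ^ ∣ T ∣ ≡ count (λ s → P (gs s)) (space c F G)
  uniform-given P P⇒low a = begin
      count (λ s → P (gs s) ∧ matches T a s) (space c F G) * K
        ≡⟨ cong (_* K) (trans (count≡sum _ (space c F G)) (sum-space _)) ⟩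
      ∑ Gs (λ gs → per-gs gs (λ s → P gs ∧ matches T a s)) * K
        ≡⟨ sum-*ʳ K Gs _ ⟨
      ∑ Gs (λ gs → per-gs gs (λ s → P gs ∧ matches T a s) * K)
        ≡⟨ sum-cong Gs conditioned ⟩
      ∑ Gs (λ gs → per-gs gs (λ _ → P gs))
        ≡⟨ trans (count≡sum _ (space c F G)) (sum-space _) ⟨
      count (λ s → P (gs s)) (space c F G) ∎
    where
    open ≡-Reasoning
    K = (m * m) ^ ∣ T ∣
    per-gs : Vec (Fin n → Fin ℓ) c → (Sample n ℓ m c → Bool) → ℕ
    per-gs gs p = ∑ F (λ f₁ → ∑ F (λ f₂ → ∑ Zs (λ z₁ → ∑ Zs (λ z₂ → ind (p (sample f₁ f₂ gs z₁ z₂))))))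
    vanishes : (gs : Vec (Fin n → Fin ℓ) c) → per-gs gs (λ _ → false) ≡ 0
    vanishes gs = trans (sum-cong F (λ _ → trans (sum-cong F (λ _ → trans (sum-cong Zs (λ _ → sum-zero Zs))
                    (sum-zero Zs))) (sum-zero F))) (sum-zero F)
    conditioned : ∀ gs → per-gs gs (λ s → P gs ∧ matches T a s) * K ≡ per-gs gs (λ _ → P gs)
    conditioned gs with P gs in Pgs
    ... | false = trans (cong (_* K) (vanishes gs)) (sym (vanishes gs))
    ... | true  = uniform-for gs (P⇒low gs Pgs) a

module _ {n ℓ m : ℕ} .{{_ : NonZero ℓ}} (k c : ℕ) (F : List (Fin n → Fin m)) (G : List (Fin n → Fin ℓ))
         (independent : Independent n (2 * k) ℓ G) (T : Subset n) where
  open Space c F G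

  allCollapse : Vec (Fin n → Fin ℓ) c → Bool
  allCollapse gs = all (collapses k T) (Vec.toList gs)

  badOn∨critOn⇒allCollapse : (gs : Vec (Fin n → Fin ℓ) c) → badOn k T gs ∨ critOn k T gs ≡ true → allCollapse gs ≡ true
  badOn∨critOn⇒allCollapse gs e = all-intro _ (Vec.toList gs) (λ g g∈gs →
    collapses-complete k T g (≤-trans (+-monoʳ-≤ k (≤maxImage k T gs g g∈gs)) (badOn∨critOn-sound k T gs e)))

  bad∨crit-bound : count (λ s → bad k T s ∨ crit k T s) (space c F G) * (ℓ ^ k) ^ c
                     ≤ (∣ T ∣ ^ (2 * k)) ^ c * length (space c F G)
  bad∨crit-bound = begin
      count (λ s → bad k T s ∨ crit k T s) (space c F G) * L ^ c
        ≤⟨ *-monoˡ-≤ (L ^ c) (count-mono _ (allCollapse ∘ gs) (space c F G) (λ s → badOn∨critOn⇒allCollapse (gs s))) ⟩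
      count (allCollapse ∘ gs) (space c F G) * L ^ c
        ≡⟨ cong (_* L ^ c) (trans (count≡sum _ (space c F G)) (trans (sum-space-gs (ind ∘ allCollapse))
             (cong (A *_) (trans (sym (count≡sum allCollapse Gs)) (count-all-vecsOver (collapses k T) G c))))) ⟩
      A * q ^ c * L ^ c
        ≡⟨ trans (*-assoc A _ _) (cong (A *_) (sym (^-distribʳ-* q L c))) ⟩
      A * (q * L) ^ c
        ≤⟨ *-monoʳ-≤ A (^-monoˡ-≤ c (count-collapses k T G independent)) ⟩
      A * (t * length G) ^ c
        ≡⟨ cong (A *_) (^-distribʳ-* t (length G) c) ⟩
      A * (t ^ c * length G ^ c)
        ≡⟨ rearrange A (t ^ c) (length G ^ c) ⟩
      t ^ c * (A * length G ^ c)
        ≡⟨ cong (t ^ c *_) length-space ⟨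
      t ^ c * length (space c F G) ∎
    where
    open ≤-Reasoning
    L = ℓ ^ k
    q = count (collapses k T) G
    t = ∣ T ∣ ^ (2 * k)
    A = length F * length F * length Zs * length Zs
    length-space : length (space c F G) ≡ A * length G ^ c
    length-space = trans (length≡sum (space c F G)) (trans (sum-space-gs (λ _ → 1))
                     (cong (A *_) (trans (sym (length≡sum Gs)) (length-vecsOver G c))))
    rearrange : ∀ a b c → a * (b * c) ≡ b * (a * c)
    rearrange = solve-∀

lemma2 : (n k c m ℓ : ℕ) .{{_ : NonZero m}} → 1 ≤ k → 1 ≤ c → 1 ≤ ℓ →
         (F : List (Fin n → Fin m)) → IsIndependent n (2 * k) m F →
         (G : List (Fin n → Fin ℓ)) → IsIndependent n (2 * k) ℓ G →
         (T : Subset n) →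
         (count (λ s → bad k T s ∨ crit k T s) (space c F G) * (ℓ ^ k) ^ c
            ≤ (∣ T ∣ ^ (2 * k)) ^ c * length (space c F G))
         × (∀ (a : Fin n → Fin m × Fin m) →
              count (λ s → good k T s ∧ matches T a s) (space c F G) * (m * m) ^ ∣ T ∣
                ≡ count (good k T) (space c F G))
         × (∀ (a : Fin n → Fin m × Fin m) →
              count (λ s → crit k T s ∧ matches T a s) (space c F G) * (m * m) ^ ∣ T ∣
                ≡ count (crit k T) (space c F G))
lemma2 n k c m ℓ _ _ 1≤ℓ F F-independent G G-independent T =
    bad∨crit-bound {{>-nonZero 1≤ℓ}} k c F G (IsIndependent⇒Independent G G-independent) T
  , uniform-given k c F F-indep G T (goodOn k T) (goodOn⇒LowDeficiency k T)
  , uniform-given k c F F-indep G T (critOn k T) (λ gs → goodOn⇒LowDeficiency k T gs ∘ critOn⇒goodOn k T gs)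
  where
  F-indep : Independent n (2 * k) m F
  F-indep = IsIndependent⇒Independent F F-independent
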